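{- Let $\mathbb{F}_s$ be a finite field of characteristic $3$, let $a\in\mathbb{F}_s$, and let $f(X)=X^3+aX+a^2$. Let $\mathrm{Tr}:\mathbb{F}_s\to\mathbb{F}_3$ denote the absolute trace. Then the possible decompositions of $f(X)$ over $\mathbb{F}_s$ are exactly as follows: (1) $f(X)$ is irreducible if, and only if, $-a$ is a nonzero square in $\mathbb{F}_s$, say $-a=b^2$ with $b\in\mathbb{F}_s$, and $\mathrm{Tr}(b)\neq 0$; (2) $f(X)=(X-\alpha)Q(X)$ with $\alpha\in\mathbb{F}_s$ and $Q(X)$ an irreducible quadratic polynomial if, and only if, $-a$ is a non-square in $\mathbb{F}_s$; (3) the case $f(X)=(X-\alpha)(X-\beta)^2$ with $\alpha,\beta\in\mathbb{F}_s$, $\alpha\neq\beta$, never occurs; (4) $f(X)$ has a unique root of multiplicity $3$ if, and only if, $a=0$; (5) $f(X)=(X-\alpha)(X-\beta)(X-\gamma)$ with $\alpha,\beta,\gamma\in\mathbb{F}_s$ pairwise distinct if, and only if, $-a$ is a nonzero square in $\mathbb{F}_s$, say $-a=b^2$, and $\mathrm{Tr}(b)=0$.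
   Context: For $s=3^m$, the absolute trace is $\mathrm{Tr}(\alpha)=\alpha+\alpha^3+\cdots+\alpha^{3^{m-1}}$. -}

module Defs where

open import Level using (Level; _⊔_) renaming (suc to lsuc)
open import Algebra.Bundles using (CommutativeRing)
open import Data.Nat using (ℕ; zero; suc; _^_)
open import Data.Fin using (Fin)
open import Data.List using (List; []; _∷_)
open import Data.Product using (Σ; ∃; _×_; _,_)
open import Data.Sum using (_⊎_)
open import Relation.Nullary using (¬_)
open import Relation.Binary.PropositionalEquality using (_≡_)

record FiniteField (c ℓ : Level) : Set (lsuc (c ⊔ ℓ)) where
  field
    commutativeRing : CommutativeRing c ℓ
  open CommutativeRing commutativeRing
  field
    1≉0       : ¬ (1# ≈ 0#)
    inverse   : ∀ x → ¬ (x ≈ 0#) → ∃ λ y → x * y ≈ 1#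
    size      : ℕ
    enum      : Fin size → Carrier
    enum-surj : ∀ x → ∃ λ i → enum i ≈ x
    enum-inj  : ∀ i j → enum i ≈ enum j → i ≡ j

-- Polynomials over a commutative ring, as coefficient lists (constant
-- term first), with equality = equality of all coefficients (so trailing
-- zeros are irrelevant).
module PolyOps {c ℓ} (R : CommutativeRing c ℓ) where
  open CommutativeRing R

  pow : Carrier → ℕ → Carrier
  pow x zero    = 1#
  pow x (suc n) = x * pow x n

  -- absolute trace for a field of size 3^m :
  -- Tr m α = α + α^3 + ... + α^(3^(m-1))
  Tr : ℕ → Carrier → Carrier
  Tr zero    α = 0#
  Tr (suc k) α = Tr k α + pow α (3 ^ k)

  Poly : Set c
  Poly = List Carrier

  coeff : Poly → ℕ → Carrier
  coeff []      _       = 0#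
  coeff (a ∷ p) zero    = a
  coeff (a ∷ p) (suc n) = coeff p n

  _≈P_ : Poly → Poly → Set ℓ
  p ≈P q = ∀ n → coeff p n ≈ coeff q n

  _+P_ : Poly → Poly → Poly
  []      +P q       = q
  (a ∷ p) +P []      = a ∷ p
  (a ∷ p) +P (b ∷ q) = (a + b) ∷ (p +P q)

  scale : Carrier → Poly → Poly
  scale a []      = []
  scale a (b ∷ q) = (a * b) ∷ scale a q

  _*P_ : Poly → Poly → Poly
  []      *P q = []
  (a ∷ p) *P q = scale a q +P (0# ∷ (p *P q))

  oneP : Poly
  oneP = 1# ∷ []

  X-_ : Carrier → Poly
  X- α = (- α) ∷ 1# ∷ []

  IsUnitP : Poly → Set (c ⊔ ℓ)
  IsUnitP p = ∃ λ q → (p *P q) ≈P oneP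

  IrreducibleP : Poly → Set (c ⊔ ℓ)
  IrreducibleP f =
    ¬ (f ≈P []) × ¬ IsUnitP f ×
    (∀ g h → f ≈P (g *P h) → IsUnitP g ⊎ IsUnitP h)

  IsQuadratic : Poly → Set (c ⊔ ℓ)
  IsQuadratic Q = Σ Carrier λ q0 → Σ Carrier λ q1 → Σ Carrier λ q2 →
    (Q ≡ q0 ∷ q1 ∷ q2 ∷ []) × ¬ (q2 ≈ 0#)

  IsSquare : Carrier → Set (c ⊔ ℓ)
  IsSquare x = ∃ λ b → x ≈ b * b

{-# OPTIONS --safe #-}
-- If x ≠ z are roots of f, then in characteristic 3
-- f(x) − f(z) = (x − z)((x − z)² + a), so −a = (x − z)² is a nonzero square. Conversely, if
-- −a = b² with b ≠ 0, the substitution X = bY turns f into b³(Y³ − Y + b), so f has a root iff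
-- y³ − y = −b is solvable, iff Tr b = 0 (Artin–Schreier, using that Tr is not identically zero);
-- the roots are then by, b(y + 1), b(y + 2). If −a is not a square, f still has a root in F,
-- found through an injective, hence bijective, self-map of F. A polynomial of degree 2 or 3
-- is irreducible iff it has no root, and the repeated-root cases follow from comparing
-- coefficients with (X − α)(X − β)(X − γ).
module Submission where

open import Defs
open import Algebra.Bundles using (CommutativeRing; RawRing)
open import Algebra.Solver.Ring.AlmostCommutativeRing
  using (fromCommutativeRing; _-Raw-AlmostCommutative⟶_)
open import Data.Empty using (⊥-elim)
open import Level using (_⊔_)
open import Data.Fin as Fin using (Fin; zero; suc; punchIn; punchOut)
import Data.Fin.Properties as Fin
open import Data.Fin.Permutation using (Permutation; permutation)
open import Data.List using (List; []; _∷_; length)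
open import Data.Maybe using (Maybe; just; nothing)
open import Data.Nat as ℕ using (ℕ; zero; suc; _^_; z≤n; s≤s)
import Data.Nat.Properties as ℕ
open import Data.Product using (∃; _×_; _,_; proj₁; proj₂)
open import Data.Sum using (_⊎_; inj₁; inj₂)
open import Function.Bundles using (_⇔_; mk⇔)
open import Relation.Binary.PropositionalEquality as ≡ using (_≡_; _≢_)
open import Relation.Nullary using (¬_; Dec; yes; no)
open import Relation.Nullary.Decidable using (map′)

data 𝔽₃ : Set where
  0₃ 1₃ 2₃ : 𝔽₃

_+₃_ : 𝔽₃ → 𝔽₃ → 𝔽₃
0₃ +₃ y  = y
1₃ +₃ 0₃ = 1₃
1₃ +₃ 1₃ = 2₃
1₃ +₃ 2₃ = 0₃
2₃ +₃ 0₃ = 2₃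
2₃ +₃ 1₃ = 0₃
2₃ +₃ 2₃ = 1₃

_*₃_ : 𝔽₃ → 𝔽₃ → 𝔽₃
0₃ *₃ y  = 0₃
1₃ *₃ y  = y
2₃ *₃ 0₃ = 0₃
2₃ *₃ 1₃ = 2₃
2₃ *₃ 2₃ = 1₃

-₃_ : 𝔽₃ → 𝔽₃
-₃ 0₃ = 0₃
-₃ 1₃ = 2₃
-₃ 2₃ = 1₃

𝔽₃-rawRing : RawRing _ _
𝔽₃-rawRing = record
  { Carrier = 𝔽₃ ; _≈_ = _≡_ ; _+_ = _+₃_ ; _*_ = _*₃_ ; -_ = -₃_ ; 0# = 0₃ ; 1# = 1₃ }

HasCharacteristic3 : ∀ {c ℓ} → CommutativeRing c ℓ → Set ℓ
HasCharacteristic3 R = 1# + 1# + 1# ≈ 0#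
  where open CommutativeRing R

module CharacteristicThreeSolver {c ℓ} (R : CommutativeRing c ℓ) (1+1+1≈0 : HasCharacteristic3 R) where
  open CommutativeRing R

  open import Algebra.Properties.Ring ring using (+-inverseˡ-unique)
  open import Relation.Binary.Reasoning.Setoid setoid

  ⟦_⟧₃ : 𝔽₃ → Carrier
  ⟦ 0₃ ⟧₃ = 0#
  ⟦ 1₃ ⟧₃ = 1#
  ⟦ 2₃ ⟧₃ = 1# + 1#

  private
    1+2≈0 : 1# + (1# + 1#) ≈ 0#
    1+2≈0 = trans (sym (+-assoc 1# 1# 1#)) 1+1+1≈0

    2+2≈1 : (1# + 1#) + (1# + 1#) ≈ 1#
    2+2≈1 = begin
      (1# + 1#) + (1# + 1#)  ≈⟨ +-assoc (1# + 1#) 1# 1# ⟨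
      (1# + 1# + 1#) + 1#    ≈⟨ +-congʳ 1+1+1≈0 ⟩
      0# + 1#                ≈⟨ +-identityˡ 1# ⟩
      1#                     ∎

    2*2≈1 : (1# + 1#) * (1# + 1#) ≈ 1#
    2*2≈1 = begin
      (1# + 1#) * (1# + 1#)              ≈⟨ distribʳ (1# + 1#) 1# 1# ⟩
      1# * (1# + 1#) + 1# * (1# + 1#)    ≈⟨ +-cong (*-identityˡ _) (*-identityˡ _) ⟩
      (1# + 1#) + (1# + 1#)              ≈⟨ 2+2≈1 ⟩
      1#                                 ∎

    +-homo : ∀ x y → ⟦ x +₃ y ⟧₃ ≈ ⟦ x ⟧₃ + ⟦ y ⟧₃
    +-homo 0₃ y  = sym (+-identityˡ _)
    +-homo 1₃ 0₃ = sym (+-identityʳ _)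
    +-homo 1₃ 1₃ = refl
    +-homo 1₃ 2₃ = sym 1+2≈0
    +-homo 2₃ 0₃ = sym (+-identityʳ _)
    +-homo 2₃ 1₃ = sym 1+1+1≈0
    +-homo 2₃ 2₃ = sym 2+2≈1

    *-homo : ∀ x y → ⟦ x *₃ y ⟧₃ ≈ ⟦ x ⟧₃ * ⟦ y ⟧₃
    *-homo 0₃ y  = sym (zeroˡ _)
    *-homo 1₃ y  = sym (*-identityˡ _)
    *-homo 2₃ 0₃ = sym (zeroʳ _)
    *-homo 2₃ 1₃ = sym (*-identityʳ _)
    *-homo 2₃ 2₃ = sym 2*2≈1

    -‿homo : ∀ x → ⟦ -₃ x ⟧₃ ≈ - ⟦ x ⟧₃
    -‿homo 0₃ = +-inverseˡ-unique 0# 0# (+-identityˡ 0#)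
    -‿homo 1₃ = +-inverseˡ-unique (1# + 1#) 1# 1+1+1≈0
    -‿homo 2₃ = +-inverseˡ-unique 1# (1# + 1#) 1+2≈0

    homomorphism : 𝔽₃-rawRing -Raw-AlmostCommutative⟶ fromCommutativeRing R
    homomorphism = record
      { ⟦_⟧ = ⟦_⟧₃ ; +-homo = +-homo ; *-homo = *-homo ; -‿homo = -‿homo
      ; 0-homo = refl ; 1-homo = refl }

    _≟₃_ : ∀ x y → Maybe (⟦ x ⟧₃ ≈ ⟦ y ⟧₃)
    0₃ ≟₃ 0₃ = just refl
    1₃ ≟₃ 1₃ = just refl
    2₃ ≟₃ 2₃ = just refl
    _  ≟₃ _  = nothing

  open import Algebra.Solver.Ring 𝔽₃-rawRing (fromCommutativeRing R) homomorphism _≟₃_ public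

module Powers {c ℓ} (R : CommutativeRing c ℓ) where
  open CommutativeRing R
  open PolyOps R using (pow)
  import Algebra.Properties.CommutativeSemiring.Exp commutativeSemiring as Exp

  private
    pow≈^ : ∀ x n → pow x n ≈ x Exp.^ n
    pow≈^ x zero    = refl
    pow≈^ x (suc n) = *-congˡ (pow≈^ x n)

  pow-cong : ∀ n {x y} → x ≈ y → pow x n ≈ pow y n
  pow-cong n {x} {y} x≈y = trans (pow≈^ x n) (trans (Exp.^-congˡ n x≈y) (sym (pow≈^ y n)))

  pow-distrib-* : ∀ x y n → pow (x * y) n ≈ pow x n * pow y n
  pow-distrib-* x y n = trans (pow≈^ (x * y) n)
    (trans (Exp.^-distrib-* x y n) (sym (*-cong (pow≈^ x n) (pow≈^ y n))))

  pow-assoc : ∀ x m n → pow (pow x m) n ≈ pow x (m ℕ.* n)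
  pow-assoc x m n = trans (pow-cong n (pow≈^ x m))
    (trans (pow≈^ (x Exp.^ m) n) (trans (Exp.^-assocʳ x m n) (sym (pow≈^ x (m ℕ.* n)))))

Fin-injective⇒surjective : ∀ {n} (g : Fin n → Fin n) → (∀ {i j} → g i ≡ g j → i ≡ j) →
                           ∀ k → ∃ λ i → g i ≡ k
Fin-injective⇒surjective g g-injective k with Fin.any? (λ i → g i Fin.≟ k)
... | yes hit = hit
Fin-injective⇒surjective {suc n} g g-injective k | no miss =
  ⊥-elim (ℕ.1+n≰n (Fin.injective⇒≤ punchOut∘g-injective))
  where
  k≢g : ∀ i → k ≢ g i
  k≢g i k≡gi = miss (i , ≡.sym k≡gi)
  punchOut∘g-injective : ∀ {i j} → punchOut (k≢g i) ≡ punchOut (k≢g j) → i ≡ j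
  punchOut∘g-injective eq = g-injective (Fin.punchOut-injective (k≢g _) (k≢g _) eq)

module FiniteFieldProperties {c ℓ} (F : FiniteField c ℓ) where
  open FiniteField F
  open CommutativeRing commutativeRing hiding (zero)
  open PolyOps commutativeRing using (pow; IsSquare)
  open Powers commutativeRing
  open import Algebra.Properties.Ring ring using (x∙y⁻¹≈ε⇒x≈y)
  import Algebra.Properties.CommutativeMonoid.Sum *-commutativeMonoid as Product
  open import Relation.Binary.Reasoning.Setoid setoid

  index : Carrier → Fin size
  index x = proj₁ (enum-surj x)

  enum-index : ∀ x → enum (index x) ≈ x
  enum-index x = proj₂ (enum-surj x)

  index-cong : ∀ {x y} → x ≈ y → index x ≡ index y
  index-cong {x} {y} x≈y = enum-inj _ _ (trans (enum-index x) (trans x≈y (sym (enum-index y))))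

  index-injective : ∀ {x y} → index x ≡ index y → x ≈ y
  index-injective {x} {y} eq =
    trans (sym (enum-index x)) (trans (reflexive (≡.cong enum eq)) (enum-index y))

  _≟_ : ∀ x y → Dec (x ≈ y)
  x ≟ y = map′ index-injective index-cong (index x Fin.≟ index y)

  size≢1 : size ≢ 1
  size≢1 size≡1 = 1≉0 (index-injective (singleton size≡1 (index 1#) (index 0#)))
    where
    singleton : ∀ {n} → n ≡ 1 → (i j : Fin n) → i ≡ j
    singleton ≡.refl zero zero = ≡.refl

  inv : ∀ x → x ≉ 0# → Carrier
  inv x x≉0 = proj₁ (inverse x x≉0)

  inverseʳ : ∀ x (x≉0 : x ≉ 0#) → x * inv x x≉0 ≈ 1#
  inverseʳ x x≉0 = proj₂ (inverse x x≉0)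

  inverseˡ : ∀ x (x≉0 : x ≉ 0#) → inv x x≉0 * x ≈ 1#
  inverseˡ x x≉0 = trans (*-comm _ x) (inverseʳ x x≉0)

  inv≉0 : ∀ x (x≉0 : x ≉ 0#) → inv x x≉0 ≉ 0#
  inv≉0 x x≉0 inv≈0 = 1≉0 (trans (sym (inverseʳ x x≉0)) (trans (*-congˡ inv≈0) (zeroʳ x)))

  *-inverse-cancel : ∀ {u v} → u * v ≈ 1# → ∀ y → u * (v * y) ≈ y
  *-inverse-cancel {u} {v} uv≈1 y = begin
    u * (v * y)  ≈⟨ *-assoc u v y ⟨
    u * v * y    ≈⟨ *-congʳ uv≈1 ⟩
    1# * y       ≈⟨ *-identityˡ y ⟩
    y            ∎

  inv-cancelˡ : ∀ x (x≉0 : x ≉ 0#) y → inv x x≉0 * (x * y) ≈ y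
  inv-cancelˡ x x≉0 = *-inverse-cancel (inverseˡ x x≉0)

  x*y≈0⇒y≈0 : ∀ {x y} → x ≉ 0# → x * y ≈ 0# → y ≈ 0#
  x*y≈0⇒y≈0 {x} {y} x≉0 xy≈0 = begin
    y                    ≈⟨ inv-cancelˡ x x≉0 y ⟨
    inv x x≉0 * (x * y)  ≈⟨ *-congˡ xy≈0 ⟩
    inv x x≉0 * 0#       ≈⟨ zeroʳ _ ⟩
    0#                   ∎

  x*y≉0 : ∀ {x y} → x ≉ 0# → y ≉ 0# → x * y ≉ 0#
  x*y≉0 x≉0 y≉0 xy≈0 = y≉0 (x*y≈0⇒y≈0 x≉0 xy≈0)

  *-cancelˡ : ∀ {x y z} → x ≉ 0# → x * y ≈ x * z → y ≈ z
  *-cancelˡ {x} {y} {z} x≉0 xy≈xz = begin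
    y                    ≈⟨ inv-cancelˡ x x≉0 y ⟨
    inv x x≉0 * (x * y)  ≈⟨ *-congˡ xy≈xz ⟩
    inv x x≉0 * (x * z)  ≈⟨ inv-cancelˡ x x≉0 z ⟩
    z                    ∎

  x-y≉0 : ∀ {x y} → x ≉ y → x - y ≉ 0#
  x-y≉0 {x} {y} x≉y x-y≈0 = x≉y (x∙y⁻¹≈ε⇒x≈y x y x-y≈0)

  injective⇒surjective : (h : Carrier → Carrier) → (∀ {x y} → h x ≈ h y → x ≈ y) →
                         ∀ z → ∃ λ x → h x ≈ z
  injective⇒surjective h h-injective z =
    let i , hi≡z = Fin-injective⇒surjective (λ i → index (h (enum i))) index∘h-injective (index z)
    in enum i , index-injective hi≡z
    where
    index∘h-injective : ∀ {i j} → index (h (enum i)) ≡ index (h (enum j)) → i ≡ j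
    index∘h-injective eq = enum-inj _ _ (h-injective (index-injective eq))


  isSquare? : ∀ x → Dec (IsSquare x)
  isSquare? x = map′ (λ (i , x≈i²) → enum i , x≈i²) witness
                     (Fin.any? (λ i → x ≟ (enum i * enum i)))
    where
    witness : IsSquare x → ∃ λ i → x ≈ enum i * enum i
    witness (b , x≈b²) = index b , trans x≈b² (sym (*-cong (enum-index b) (enum-index b)))

  ∏ : ∀ {n} → (Fin n → Carrier) → Carrier
  ∏ = Product.sum

  ∏-cong : ∀ {n} {u v : Fin n → Carrier} → (∀ i → u i ≈ v i) → ∏ u ≈ ∏ v
  ∏-cong = Product.sum-cong-≋

  ∏-const : ∀ n x → ∏ {n} (λ _ → x) ≈ pow x n
  ∏-const zero    x = refl
  ∏-const (suc n) x = *-congˡ (∏-const n x)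

  ∏≉0 : ∀ {n} (u : Fin n → Carrier) → (∀ i → u i ≉ 0#) → ∏ u ≉ 0#
  ∏≉0 {zero}  u u≉0 = 1≉0
  ∏≉0 {suc n} u u≉0 = x*y≉0 (u≉0 zero) (∏≉0 (λ i → u (suc i)) (λ i → u≉0 (suc i)))

  private
    module Units {n} (e : Fin (suc n) → Carrier) (e-injective : ∀ i j → e i ≈ e j → i ≡ j)
                 (e-surjective : ∀ x → ∃ λ i → e i ≈ x) where

      zeroIndex : Fin (suc n)
      zeroIndex = proj₁ (e-surjective 0#)

      unit : Fin n → Carrier
      unit j = e (punchIn zeroIndex j)

      unit≉0 : ∀ j → unit j ≉ 0#
      unit≉0 j unit≈0 = Fin.punchInᵢ≢i zeroIndex j
        (e-injective _ _ (trans unit≈0 (sym (proj₂ (e-surjective 0#)))))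

      unit-injective : ∀ {i j} → unit i ≈ unit j → i ≡ j
      unit-injective eq = Fin.punchIn-injective zeroIndex _ _ (e-injective _ _ eq)

      unitIndex : ∀ y → y ≉ 0# → Fin n
      unitIndex y y≉0 = punchOut zeroIndex≢
        where
        zeroIndex≢ : zeroIndex ≢ proj₁ (e-surjective y)
        zeroIndex≢ eq = y≉0 (trans (sym (proj₂ (e-surjective y)))
          (trans (reflexive (≡.cong e (≡.sym eq))) (proj₂ (e-surjective 0#))))

      unit-unitIndex : ∀ y (y≉0 : y ≉ 0#) → unit (unitIndex y y≉0) ≈ y
      unit-unitIndex y y≉0 =
        trans (reflexive (≡.cong e (Fin.punchIn-punchOut _))) (proj₂ (e-surjective y))

      scale : ∀ x → x ≉ 0# → Fin n → Fin n
      scale x x≉0 j = unitIndex (x * unit j) (x*y≉0 x≉0 (unit≉0 j))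

      unit-scale : ∀ x (x≉0 : x ≉ 0#) j → unit (scale x x≉0 j) ≈ x * unit j
      unit-scale x x≉0 j = unit-unitIndex (x * unit j) (x*y≉0 x≉0 (unit≉0 j))

      scale-inverse : ∀ {x y} (x≉0 : x ≉ 0#) (y≉0 : y ≉ 0#) → x * y ≈ 1# →
                      ∀ j → scale x x≉0 (scale y y≉0 j) ≡ j
      scale-inverse {x} {y} x≉0 y≉0 xy≈1 j = unit-injective (begin
        unit (scale x x≉0 (scale y y≉0 j))  ≈⟨ unit-scale x x≉0 _ ⟩
        x * unit (scale y y≉0 j)            ≈⟨ *-congˡ (unit-scale y y≉0 j) ⟩
        x * (y * unit j)                    ≈⟨ *-inverse-cancel xy≈1 (unit j) ⟩
        unit j                              ∎)

      -- Multiplication by x permutes the nonzero elements, so it fixes their product.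
      pow-n≈1 : ∀ x → x ≉ 0# → pow x n ≈ 1#
      pow-n≈1 x x≉0 = sym (*-cancelˡ (∏≉0 unit unit≉0) (begin
        ∏ unit * 1#                       ≈⟨ *-identityʳ _ ⟩
        ∏ unit                            ≈⟨ Product.sum-permute unit π ⟩
        ∏ (λ j → unit (scale x x≉0 j))    ≈⟨ ∏-cong (unit-scale x x≉0) ⟩
        ∏ (λ j → x * unit j)              ≈⟨ Product.∑-distrib-+ (λ _ → x) unit ⟩
        ∏ {n} (λ _ → x) * ∏ unit          ≈⟨ *-congʳ (∏-const n x) ⟩
        pow x n * ∏ unit                  ≈⟨ *-comm _ _ ⟩
        ∏ unit * pow x n                  ∎))
        where
        x⁻¹≉0 : inv x x≉0 ≉ 0#
        x⁻¹≉0 = inv≉0 x x≉0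
        π : Permutation n n
        π = permutation (scale x x≉0) (scale (inv x x≉0) x⁻¹≉0)
              (scale-inverse x≉0 x⁻¹≉0 (inverseʳ x x≉0))
              (scale-inverse x⁻¹≉0 x≉0 (inverseˡ x x≉0))

  private
    fermat′ : ∀ n (e : Fin n → Carrier) → (∀ i j → e i ≈ e j → i ≡ j) →
              (∀ x → ∃ λ i → e i ≈ x) → ∀ x → pow x n ≈ x
    fermat′ zero    e e-injective e-surjective x with () ← proj₁ (e-surjective x)
    fermat′ (suc n) e e-injective e-surjective x with x ≟ 0#
    ... | yes x≈0 = trans (*-congʳ x≈0) (trans (zeroˡ _) (sym x≈0))
    ... | no  x≉0 = trans (*-congˡ (pow-n≈1 x x≉0)) (*-identityʳ x)
      where open Units e e-injective e-surjective

  fermat : ∀ x → pow x size ≈ x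
  fermat = fermat′ size enum enum-inj enum-surj

module Polynomials {c ℓ} (R : CommutativeRing c ℓ) where
  open CommutativeRing R hiding (zero)
  open PolyOps R
  open Powers R
  open import Algebra.Properties.Ring ring using (-‿distribˡ-*; -0#≈0#)
  open import Algebra.Properties.CommutativeSemigroup +-commutativeSemigroup
    using () renaming (interchange to +-interchange)
  open import Algebra.Properties.CommutativeSemigroup *-commutativeSemigroup
    using () renaming (x∙yz≈y∙xz to *-leftSwap)
  open import Relation.Binary.Reasoning.Setoid setoid

  ≈P-sym : ∀ p q → p ≈P q → q ≈P p
  ≈P-sym p q p≈q n = sym (p≈q n)

  ≈P-trans : ∀ p q r → p ≈P q → q ≈P r → p ≈P r
  ≈P-trans p q r p≈q q≈r n = trans (p≈q n) (q≈r n)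

  coeff-+P : ∀ p q n → coeff (p +P q) n ≈ coeff p n + coeff q n
  coeff-+P []      q       n       = sym (+-identityˡ _)
  coeff-+P (a ∷ p) []      n       = sym (+-identityʳ _)
  coeff-+P (a ∷ p) (b ∷ q) zero    = refl
  coeff-+P (a ∷ p) (b ∷ q) (suc n) = coeff-+P p q n

  coeff-scale : ∀ a q n → coeff (scale a q) n ≈ a * coeff q n
  coeff-scale a []      n       = sym (zeroʳ a)
  coeff-scale a (b ∷ q) zero    = refl
  coeff-scale a (b ∷ q) (suc n) = coeff-scale a q n

  coeff-*P-zero : ∀ a p q → coeff ((a ∷ p) *P q) 0 ≈ a * coeff q 0
  coeff-*P-zero a p q = begin
    coeff (scale a q +P (0# ∷ (p *P q))) 0  ≈⟨ coeff-+P (scale a q) _ 0 ⟩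
    coeff (scale a q) 0 + 0#                ≈⟨ +-identityʳ _ ⟩
    coeff (scale a q) 0                     ≈⟨ coeff-scale a q 0 ⟩
    a * coeff q 0                           ∎

  coeff-*P-suc : ∀ a p q n → coeff ((a ∷ p) *P q) (suc n) ≈ a * coeff q (suc n) + coeff (p *P q) n
  coeff-*P-suc a p q n =
    trans (coeff-+P (scale a q) _ (suc n)) (+-congʳ (coeff-scale a q (suc n)))

  *P-zeroˡ : ∀ p q → p ≈P [] → (p *P q) ≈P []
  *P-zeroˡ []      q p≈0 n       = refl
  *P-zeroˡ (a ∷ p) q p≈0 zero    =
    trans (coeff-*P-zero a p q) (trans (*-congʳ (p≈0 0)) (zeroˡ _))
  *P-zeroˡ (a ∷ p) q p≈0 (suc n) = begin
    coeff ((a ∷ p) *P q) (suc n)            ≈⟨ coeff-*P-suc a p q n ⟩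
    a * coeff q (suc n) + coeff (p *P q) n  ≈⟨ +-cong (*-congʳ (p≈0 0)) (*P-zeroˡ p q (λ k → p≈0 (suc k)) n) ⟩
    0# * coeff q (suc n) + 0#               ≈⟨ trans (+-identityʳ _) (zeroˡ _) ⟩
    0#                                      ∎

  *P-zeroʳ : ∀ p q → q ≈P [] → (p *P q) ≈P []
  *P-zeroʳ []      q q≈0 n       = refl
  *P-zeroʳ (a ∷ p) q q≈0 zero    = trans (coeff-*P-zero a p q) (trans (*-congˡ (q≈0 0)) (zeroʳ a))
  *P-zeroʳ (a ∷ p) q q≈0 (suc n) = begin
    coeff ((a ∷ p) *P q) (suc n)            ≈⟨ coeff-*P-suc a p q n ⟩
    a * coeff q (suc n) + coeff (p *P q) n  ≈⟨ +-cong (*-congˡ (q≈0 (suc n))) (*P-zeroʳ p q q≈0 n) ⟩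
    a * 0# + 0#                             ≈⟨ trans (+-identityʳ _) (zeroʳ a) ⟩
    0#                                      ∎

  eval : Poly → Carrier → Carrier
  eval []      x = 0#
  eval (a ∷ p) x = a + x * eval p x

  eval-cong : ∀ p {x y} → x ≈ y → eval p x ≈ eval p y
  eval-cong []      x≈y = refl
  eval-cong (a ∷ p) x≈y = +-congˡ (*-cong x≈y (eval-cong p x≈y))

  eval-≈[] : ∀ p x → p ≈P [] → eval p x ≈ 0#
  eval-≈[] []      x p≈0 = refl
  eval-≈[] (a ∷ p) x p≈0 = begin
    a + x * eval p x  ≈⟨ +-cong (p≈0 0) (*-congˡ (eval-≈[] p x (λ n → p≈0 (suc n)))) ⟩
    0# + x * 0#       ≈⟨ trans (+-identityˡ _) (zeroʳ x) ⟩
    0#                ∎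

  eval-resp : ∀ p q x → p ≈P q → eval p x ≈ eval q x
  eval-resp []      q       x p≈q = sym (eval-≈[] q x (≈P-sym [] q p≈q))
  eval-resp (a ∷ p) []      x p≈q = eval-≈[] (a ∷ p) x p≈q
  eval-resp (a ∷ p) (b ∷ q) x p≈q =
    +-cong (p≈q 0) (*-congˡ (eval-resp p q x (λ n → p≈q (suc n))))

  eval-+P : ∀ p q x → eval (p +P q) x ≈ eval p x + eval q x
  eval-+P []      q       x = sym (+-identityˡ _)
  eval-+P (a ∷ p) []      x = sym (+-identityʳ _)
  eval-+P (a ∷ p) (b ∷ q) x = begin
    (a + b) + x * eval (p +P q) x               ≈⟨ +-congˡ (*-congˡ (eval-+P p q x)) ⟩
    (a + b) + x * (eval p x + eval q x)         ≈⟨ +-congˡ (distribˡ x _ _) ⟩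
    (a + b) + (x * eval p x + x * eval q x)     ≈⟨ +-interchange a b _ _ ⟩
    (a + x * eval p x) + (b + x * eval q x)     ∎

  eval-scale : ∀ a q x → eval (scale a q) x ≈ a * eval q x
  eval-scale a []      x = sym (zeroʳ a)
  eval-scale a (b ∷ q) x = begin
    a * b + x * eval (scale a q) x  ≈⟨ +-congˡ (*-congˡ (eval-scale a q x)) ⟩
    a * b + x * (a * eval q x)      ≈⟨ +-congˡ (*-leftSwap x a _) ⟩
    a * b + a * (x * eval q x)      ≈⟨ distribˡ a b _ ⟨
    a * (b + x * eval q x)          ∎

  eval-*P : ∀ p q x → eval (p *P q) x ≈ eval p x * eval q x
  eval-*P []      q x = sym (zeroˡ _)
  eval-*P (a ∷ p) q x = begin
    eval (scale a q +P (0# ∷ (p *P q))) x              ≈⟨ eval-+P (scale a q) _ x ⟩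
    eval (scale a q) x + (0# + x * eval (p *P q) x)    ≈⟨ +-cong (eval-scale a q x) (+-identityˡ _) ⟩
    a * eval q x + x * eval (p *P q) x                 ≈⟨ +-congˡ (*-congˡ (eval-*P p q x)) ⟩
    a * eval q x + x * (eval p x * eval q x)           ≈⟨ +-congˡ (*-assoc x _ _) ⟨
    a * eval q x + x * eval p x * eval q x             ≈⟨ distribʳ _ a _ ⟨
    (a + x * eval p x) * eval q x                      ∎

  eval-X- : ∀ α x → eval (X- α) x ≈ x - α
  eval-X- α x = begin
    - α + x * (1# + x * 0#)  ≈⟨ +-congˡ (*-congˡ (trans (+-congˡ (zeroʳ x)) (+-identityʳ 1#))) ⟩
    - α + x * 1#             ≈⟨ +-congˡ (*-identityʳ x) ⟩
    - α + x                  ≈⟨ +-comm _ x ⟩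
    x - α                    ∎

  eval-X-self : ∀ α → eval (X- α) α ≈ 0#
  eval-X-self α = trans (eval-X- α α) (-‿inverseʳ α)

  DegreeBelow : ℕ → Poly → Set ℓ
  DegreeBelow d p = ∀ n → d ℕ.≤ n → coeff p n ≈ 0#

  HasDegree : ℕ → Poly → Set ℓ
  HasDegree d p = DegreeBelow (suc d) p × coeff p d ≉ 0#

  eval-at-0 : ∀ p → eval p 0# ≈ coeff p 0
  eval-at-0 []      = refl
  eval-at-0 (a ∷ p) = trans (+-congˡ (zeroˡ _)) (+-identityʳ a)

  length-degree : ∀ p → DegreeBelow (length p) p
  length-degree []      n       _         = refl
  length-degree (a ∷ p) (suc n) (s≤s p<n) = length-degree p n p<n

  DegreeBelow-mono : ∀ {d e p} → d ℕ.≤ e → DegreeBelow d p → DegreeBelow e p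
  DegreeBelow-mono d≤e p<d n e≤n = p<d n (ℕ.≤-trans d≤e e≤n)

  DegreeBelow-+P : ∀ {d} p q → DegreeBelow d p → DegreeBelow d q → DegreeBelow d (p +P q)
  DegreeBelow-+P p q p<d q<d n d≤n =
    trans (coeff-+P p q n) (trans (+-cong (p<d n d≤n) (q<d n d≤n)) (+-identityʳ 0#))

  *P-top : ∀ {d e} p q → DegreeBelow (suc d) p → DegreeBelow (suc e) q →
           DegreeBelow (suc (d ℕ.+ e)) (p *P q) × coeff (p *P q) (d ℕ.+ e) ≈ coeff p d * coeff q e
  *P-top []      q p<d q<e = (λ _ _ → refl) , sym (zeroˡ _)
  *P-top {zero} {e} (a ∷ p) q p<1 q<e = bound , top
    where
    p≈0 : p ≈P []
    p≈0 n = p<1 (suc n) (s≤s z≤n)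
    coeff≈ : ∀ n → coeff ((a ∷ p) *P q) n ≈ a * coeff q n
    coeff≈ zero    = coeff-*P-zero a p q
    coeff≈ (suc n) = trans (coeff-*P-suc a p q n)
      (trans (+-congˡ (*P-zeroˡ p q p≈0 n)) (+-identityʳ _))
    bound : DegreeBelow (suc e) ((a ∷ p) *P q)
    bound n e<n = trans (coeff≈ n) (trans (*-congˡ (q<e n e<n)) (zeroʳ a))
    top : coeff ((a ∷ p) *P q) e ≈ a * coeff q e
    top = coeff≈ e
  *P-top {suc d} {e} (a ∷ p) q p<d q<e = bound , top
    where
    IH : DegreeBelow (suc (d ℕ.+ e)) (p *P q) × coeff (p *P q) (d ℕ.+ e) ≈ coeff p d * coeff q e
    IH = *P-top {d} p q (λ n d<n → p<d (suc n) (s≤s d<n)) q<e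
    qe≈0 : ∀ {n} → d ℕ.+ e ℕ.≤ n → a * coeff q (suc n) ≈ 0#
    qe≈0 {n} le = trans (*-congˡ (q<e (suc n) (s≤s (ℕ.≤-trans (ℕ.m≤n+m e d) le)))) (zeroʳ a)
    bound : DegreeBelow (suc (suc d ℕ.+ e)) ((a ∷ p) *P q)
    bound (suc n) (s≤s le) = begin
      coeff ((a ∷ p) *P q) (suc n)            ≈⟨ coeff-*P-suc a p q n ⟩
      a * coeff q (suc n) + coeff (p *P q) n  ≈⟨ +-cong (qe≈0 (ℕ.<⇒≤ le)) (proj₁ IH n le) ⟩
      0# + 0#                                 ≈⟨ +-identityˡ 0# ⟩
      0#                                      ∎
    top : coeff ((a ∷ p) *P q) (suc (d ℕ.+ e)) ≈ coeff p d * coeff q e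
    top = begin
      coeff ((a ∷ p) *P q) (suc (d ℕ.+ e))                ≈⟨ coeff-*P-suc a p q _ ⟩
      a * coeff q (suc (d ℕ.+ e)) + coeff (p *P q) (d ℕ.+ e)  ≈⟨ +-cong (qe≈0 ℕ.≤-refl) (proj₂ IH) ⟩
      0# + coeff p d * coeff q e                          ≈⟨ +-identityˡ _ ⟩
      coeff p d * coeff q e                               ∎

  *P-identityˡ : ∀ q → ((1# ∷ []) *P q) ≈P q
  *P-identityˡ q zero    = trans (coeff-*P-zero 1# [] q) (*-identityˡ _)
  *P-identityˡ q (suc n) =
    trans (coeff-*P-suc 1# [] q n) (trans (+-identityʳ _) (*-identityˡ _))

  coeff-X-*P-zero : ∀ r q → coeff ((X- r) *P q) 0 ≈ - r * coeff q 0
  coeff-X-*P-zero r = coeff-*P-zero (- r) (1# ∷ [])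

  coeff-X-*P-suc : ∀ r q n → coeff ((X- r) *P q) (suc n) ≈ coeff q n - r * coeff q (suc n)
  coeff-X-*P-suc r q n = begin
    coeff ((X- r) *P q) (suc n)                        ≈⟨ coeff-*P-suc (- r) (1# ∷ []) q n ⟩
    - r * coeff q (suc n) + coeff ((1# ∷ []) *P q) n   ≈⟨ +-congˡ (*P-identityˡ q n) ⟩
    - r * coeff q (suc n) + coeff q n                  ≈⟨ +-comm _ _ ⟩
    coeff q n + - r * coeff q (suc n)                  ≈⟨ +-congˡ (-‿distribˡ-* r _) ⟨
    coeff q n - r * coeff q (suc n)                    ∎

  -- The quotient of p by X - r, computed by Horner's scheme.
  quot : Carrier → Poly → Poly
  quot r []          = []
  quot r (a ∷ [])    = []
  quot r (a ∷ b ∷ p) = eval (b ∷ p) r ∷ quot r (b ∷ p)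

  private
    x≈-ry+[x+ry] : ∀ x r y → x ≈ - r * y + (x + r * y)
    x≈-ry+[x+ry] x r y = sym (begin
      - r * y + (x + r * y)     ≈⟨ +-comm _ _ ⟩
      (x + r * y) + - r * y     ≈⟨ +-assoc x _ _ ⟩
      x + (r * y + - r * y)     ≈⟨ +-congˡ (+-congˡ (-‿distribˡ-* r y)) ⟨
      x + (r * y - r * y)       ≈⟨ +-congˡ (-‿inverseʳ _) ⟩
      x + 0#                    ≈⟨ +-identityʳ x ⟩
      x                         ∎)

    0≈0-r*0 : ∀ r → 0# ≈ 0# - r * 0#
    0≈0-r*0 r = sym (trans (+-congˡ (trans (-‿cong (zeroʳ r)) -0#≈0#)) (+-identityʳ 0#))

    quot-coeff-zero : ∀ r p → coeff p 0 ≈ - r * coeff (quot r p) 0 + eval p r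
    quot-coeff-zero r []          = sym (trans (+-identityʳ _) (zeroʳ _))
    quot-coeff-zero r (a ∷ [])    = x≈-ry+[x+ry] a r 0#
    quot-coeff-zero r (a ∷ b ∷ p) = x≈-ry+[x+ry] a r (eval (b ∷ p) r)

    quot-coeff-suc : ∀ r p n → coeff p (suc n) ≈ coeff (quot r p) n - r * coeff (quot r p) (suc n)
    quot-coeff-suc r []          n       = 0≈0-r*0 r
    quot-coeff-suc r (a ∷ [])    n       = 0≈0-r*0 r
    quot-coeff-suc r (a ∷ b ∷ p) zero    = begin
      b                                                  ≈⟨ quot-coeff-zero r (b ∷ p) ⟩
      - r * coeff (quot r (b ∷ p)) 0 + eval (b ∷ p) r    ≈⟨ +-comm _ _ ⟩
      eval (b ∷ p) r + - r * coeff (quot r (b ∷ p)) 0    ≈⟨ +-congˡ (-‿distribˡ-* r _) ⟨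
      eval (b ∷ p) r - r * coeff (quot r (b ∷ p)) 0      ∎
    quot-coeff-suc r (a ∷ b ∷ p) (suc n) = quot-coeff-suc r (b ∷ p) n

  factor : ∀ r p → p ≈P (((X- r) *P quot r p) +P (eval p r ∷ []))
  factor r p zero = begin
    coeff p 0                                          ≈⟨ quot-coeff-zero r p ⟩
    - r * coeff (quot r p) 0 + eval p r                ≈⟨ +-congʳ (coeff-X-*P-zero r (quot r p)) ⟨
    coeff ((X- r) *P quot r p) 0 + eval p r            ≈⟨ coeff-+P ((X- r) *P quot r p) (eval p r ∷ []) 0 ⟨
    coeff (((X- r) *P quot r p) +P (eval p r ∷ [])) 0  ∎
  factor r p (suc n) = begin
    coeff p (suc n)                                           ≈⟨ quot-coeff-suc r p n ⟩
    coeff (quot r p) n - r * coeff (quot r p) (suc n)         ≈⟨ coeff-X-*P-suc r (quot r p) n ⟨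
    coeff ((X- r) *P quot r p) (suc n)                        ≈⟨ +-identityʳ _ ⟨
    coeff ((X- r) *P quot r p) (suc n) + 0#                   ≈⟨ coeff-+P ((X- r) *P quot r p) (eval p r ∷ []) (suc n) ⟨
    coeff (((X- r) *P quot r p) +P (eval p r ∷ [])) (suc n)  ∎

  root⇒factor : ∀ r p → eval p r ≈ 0# → p ≈P ((X- r) *P quot r p)
  root⇒factor r p pr≈0 n = trans (factor r p n)
    (trans (coeff-+P ((X- r) *P quot r p) (eval p r ∷ []) n) (trans (+-congˡ (remainder≈0 n)) (+-identityʳ _)))
    where
    remainder≈0 : ∀ n → coeff (eval p r ∷ []) n ≈ 0#
    remainder≈0 zero    = pr≈0
    remainder≈0 (suc n) = refl

  quot-degree : ∀ {d} r p → DegreeBelow (suc d) p → DegreeBelow d (quot r p)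
  quot-degree r []          p<d n d≤n = refl
  quot-degree r (a ∷ [])    p<d n d≤n = refl
  quot-degree {zero} r (a ∷ b ∷ p) p<1 n _ = quot≈0 n
    where
    quot≈0 : quot r (a ∷ b ∷ p) ≈P []
    quot≈0 zero    = eval-≈[] (b ∷ p) r (λ k → p<1 (suc k) (s≤s z≤n))
    quot≈0 (suc k) = quot-degree {zero} r (b ∷ p) (λ j _ → p<1 (suc j) (s≤s z≤n)) k z≤n
  quot-degree {suc d} r (a ∷ b ∷ p) p<d (suc n) (s≤s d≤n) =
    quot-degree {d} r (b ∷ p) (λ k d<k → p<d (suc k) (s≤s d<k)) n d≤n

  X^ : ℕ → Poly
  X^ zero    = 1# ∷ []
  X^ (suc n) = 0# ∷ X^ n

  eval-X^ : ∀ n x → eval (X^ n) x ≈ pow x n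
  eval-X^ zero    x = trans (+-congˡ (zeroʳ x)) (+-identityʳ 1#)
  eval-X^ (suc n) x = trans (+-identityˡ _) (*-congˡ (eval-X^ n x))

  coeff-X^ : ∀ n → coeff (X^ n) n ≈ 1#
  coeff-X^ zero    = refl
  coeff-X^ (suc n) = coeff-X^ n

  X^-degree : ∀ n → DegreeBelow (suc n) (X^ n)
  X^-degree zero    (suc k) _         = refl
  X^-degree (suc n) (suc k) (s≤s n<k) = X^-degree n k n<k

module PolynomialsOverFiniteField {c ℓ} (F : FiniteField c ℓ) where
  open FiniteField F
  open CommutativeRing commutativeRing hiding (zero)
  open PolyOps commutativeRing
  open Polynomials commutativeRing
  open FiniteFieldProperties F
  open import Algebra.Properties.Ring ring using (-‿distribˡ-*)
  open import Relation.Binary.Definitions using (tri<; tri≈; tri>)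
  open import Relation.Binary.Reasoning.Setoid setoid

  degree-or-zero : ∀ p → p ≈P [] ⊎ ∃ λ d → HasDegree d p
  degree-or-zero []      = inj₁ (λ _ → refl)
  degree-or-zero (a ∷ p) with degree-or-zero p
  ... | inj₂ (d , p<d , pd≉0) = inj₂ (suc d , (λ { (suc n) (s≤s d<n) → p<d n d<n }) , pd≉0)
  ... | inj₁ p≈0 with a ≟ 0#
  ...   | yes a≈0 = inj₁ λ { zero → a≈0 ; (suc n) → p≈0 n }
  ...   | no  a≉0 = inj₂ (0 , (λ { (suc n) _ → p≈0 n }) , a≉0)

  quadratic-degree : ∀ Q → IsQuadratic Q → HasDegree 2 Q
  quadratic-degree Q (_ , _ , _ , ≡.refl , q2≉0) = length-degree Q , q2≉0

  oneP-degree : HasDegree 0 oneP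
  oneP-degree = (λ { (suc n) _ → refl }) , 1≉0

  X--degree : ∀ r → HasDegree 1 (X- r)
  X--degree r = (λ { (suc zero) (s≤s ()) ; (suc (suc n)) _ → refl }) , 1≉0

  HasDegree-*P : ∀ {d e} p q → HasDegree d p → HasDegree e q → HasDegree (d ℕ.+ e) (p *P q)
  HasDegree-*P p q (p<d , pd≉0) (q<e , qe≉0) =
    proj₁ (*P-top p q p<d q<e) , λ top≈0 → x*y≉0 pd≉0 qe≉0 (trans (sym (proj₂ (*P-top p q p<d q<e))) top≈0)

  HasDegree-unique : ∀ {d e} p q → p ≈P q → HasDegree d p → HasDegree e q → d ≡ e
  HasDegree-unique {d} {e} p q p≈q (p<d , pd≉0) (q<e , qe≉0) with ℕ.<-cmp d e
  ... | tri< d<e _ _ = ⊥-elim (qe≉0 (trans (sym (p≈q e)) (p<d e d<e)))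
  ... | tri≈ _ d≡e _ = d≡e
  ... | tri> _ _ e<d = ⊥-elim (pd≉0 (trans (p≈q d) (q<e d e<d)))

  *P-const : ∀ p a n → coeff (p *P (a ∷ [])) n ≈ coeff p n * a
  *P-const []      a n       = sym (zeroˡ a)
  *P-const (b ∷ p) a zero    = coeff-*P-zero b p (a ∷ [])
  *P-const (b ∷ p) a (suc n) =
    trans (coeff-*P-suc b p (a ∷ []) n) (trans (+-cong (zeroʳ b) (*P-const p a n)) (+-identityˡ _))

  constant⇒unit : ∀ p → DegreeBelow 1 p → coeff p 0 ≉ 0# → IsUnitP p
  constant⇒unit p p<1 p0≉0 = inv (coeff p 0) p0≉0 ∷ [] , product≈1
    where
    product≈1 : (p *P (inv (coeff p 0) p0≉0 ∷ [])) ≈P oneP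
    product≈1 zero    = trans (*P-const p _ 0) (inverseʳ _ p0≉0)
    product≈1 (suc n) = trans (*P-const p _ (suc n)) (trans (*-congʳ (p<1 (suc n) (s≤s z≤n))) (zeroˡ _))

  unit⇒constant : ∀ p → IsUnitP p → DegreeBelow 1 p
  unit⇒constant p (q , pq≈1) with degree-or-zero p | degree-or-zero q
  ... | inj₁ p≈0 | _        = ⊥-elim (1≉0 (trans (sym (pq≈1 0)) (*P-zeroˡ p q p≈0 0)))
  ... | inj₂ _   | inj₁ q≈0 = ⊥-elim (1≉0 (trans (sym (pq≈1 0)) (*P-zeroʳ p q q≈0 0)))
  ... | inj₂ (d , p<d , pd≉0) | inj₂ (e , q-degree) =
    ≡.subst (λ d → DegreeBelow (suc d) p) (ℕ.m+n≡0⇒m≡0 d d+e≡0) p<d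
    where
    d+e≡0 : d ℕ.+ e ≡ 0
    d+e≡0 = HasDegree-unique (p *P q) oneP pq≈1 (HasDegree-*P p q (p<d , pd≉0) q-degree) oneP-degree

  root⇒nonunit : ∀ p r → eval p r ≈ 0# → ¬ IsUnitP p
  root⇒nonunit p r pr≈0 (q , pq≈1) = 1≉0 (begin
    1#                     ≈⟨ trans (+-congˡ (zeroʳ r)) (+-identityʳ 1#) ⟨
    eval oneP r            ≈⟨ eval-resp (p *P q) oneP r pq≈1 ⟨
    eval (p *P q) r        ≈⟨ eval-*P p q r ⟩
    eval p r * eval q r    ≈⟨ *-congʳ pr≈0 ⟩
    0# * eval q r          ≈⟨ zeroˡ _ ⟩
    0#                     ∎)

  root-of-factor : ∀ {p} g h x → p ≈P (g *P h) → eval g x ≈ 0# ⊎ eval h x ≈ 0# → eval p x ≈ 0#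
  root-of-factor {p} g h x p≈gh root = trans (eval-resp p (g *P h) x p≈gh) (trans (eval-*P g h x) (product≈0 root))
    where
    product≈0 : eval g x ≈ 0# ⊎ eval h x ≈ 0# → eval g x * eval h x ≈ 0#
    product≈0 (inj₁ gx≈0) = trans (*-congʳ gx≈0) (zeroˡ _)
    product≈0 (inj₂ hx≈0) = trans (*-congˡ hx≈0) (zeroʳ _)

  root-of-cofactor : ∀ {p} α g ρ → p ≈P ((X- α) *P g) → eval p ρ ≈ 0# → ρ ≉ α → eval g ρ ≈ 0#
  root-of-cofactor {p} α g ρ p≈ pρ≈0 ρ≉α = x*y≈0⇒y≈0 (x-y≉0 ρ≉α) (begin
    (ρ - α) * eval g ρ         ≈⟨ *-congʳ (eval-X- α ρ) ⟨
    eval (X- α) ρ * eval g ρ   ≈⟨ eval-*P (X- α) g ρ ⟨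
    eval ((X- α) *P g) ρ       ≈⟨ eval-resp p ((X- α) *P g) ρ p≈ ⟨
    eval p ρ                   ≈⟨ pρ≈0 ⟩
    0#                         ∎)

  linear-root : ∀ p → HasDegree 1 p → ∃ λ r → eval p r ≈ 0#
  linear-root []             (_ , p1≉0)   = ⊥-elim (p1≉0 refl)
  linear-root (a ∷ [])       (_ , p1≉0)   = ⊥-elim (p1≉0 refl)
  linear-root (a ∷ b ∷ rest) (p<2 , b≉0) = r , (begin
    a + r * (b + r * eval rest r)  ≈⟨ +-congˡ (*-congˡ (+-congˡ (*-congˡ rest≈0))) ⟩
    a + r * (b + r * 0#)           ≈⟨ +-congˡ (*-congˡ (trans (+-congˡ (zeroʳ r)) (+-identityʳ b))) ⟩
    a + r * b                      ≈⟨ +-congˡ (-‿distribˡ-* _ b) ⟨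
    a - a * inv b b≉0 * b          ≈⟨ +-congˡ (-‿cong (*-assoc a _ b)) ⟩
    a - a * (inv b b≉0 * b)        ≈⟨ +-congˡ (-‿cong (trans (*-congˡ (inverseˡ b b≉0)) (*-identityʳ a))) ⟩
    a - a                          ≈⟨ -‿inverseʳ a ⟩
    0#                             ∎)
    where
    r : Carrier
    r = - (a * inv b b≉0)
    rest≈0 : eval rest r ≈ 0#
    rest≈0 = eval-≈[] rest r (λ n → p<2 (suc (suc n)) (s≤s (s≤s z≤n)))

  root⇒reducible : ∀ {D} p r → 2 ℕ.≤ D → HasDegree D p → eval p r ≈ 0# → ¬ IrreducibleP p
  root⇒reducible {D} p r 2≤D (_ , pD≉0) pr≈0 (_ , _ , factors-trivially)
    with factors-trivially (X- r) (quot r p) (root⇒factor r p pr≈0)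
  ... | inj₁ X-r-unit  = root⇒nonunit (X- r) r (eval-X-self r) X-r-unit
  ... | inj₂ quot-unit = pD≉0 (trans (root⇒factor r p pr≈0 D) (product<2 D 2≤D))
    where
    product<2 : DegreeBelow 2 ((X- r) *P quot r p)
    product<2 = proj₁ (*P-top (X- r) (quot r p) (proj₁ (X--degree r)) (unit⇒constant (quot r p) quot-unit))

  rootless⇒irreducible : ∀ {D} p → 2 ℕ.≤ D → D ℕ.≤ 3 → HasDegree D p →
                         (∀ x → eval p x ≉ 0#) → IrreducibleP p
  rootless⇒irreducible {D} p 2≤D D≤3 p-degree@(_ , pD≉0) rootless = p≉0 , p-nonunit , factors-trivially
    where
    p≉0 : ¬ p ≈P []
    p≉0 p≈0 = pD≉0 (p≈0 D)

    p-nonunit : ¬ IsUnitP p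
    p-nonunit p-unit = pD≉0 (unit⇒constant p p-unit D (ℕ.≤-trans (s≤s z≤n) 2≤D))

    factors-trivially : ∀ g h → p ≈P (g *P h) → IsUnitP g ⊎ IsUnitP h
    factors-trivially g h p≈gh with degree-or-zero g | degree-or-zero h
    ... | inj₁ g≈0 | _        = ⊥-elim (p≉0 (≈P-trans p (g *P h) [] p≈gh (*P-zeroˡ g h g≈0)))
    ... | inj₂ _   | inj₁ h≈0 = ⊥-elim (p≉0 (≈P-trans p (g *P h) [] p≈gh (*P-zeroʳ g h h≈0)))
    ... | inj₂ (d , g-degree) | inj₂ (e , h-degree) = by-degrees d e g-degree h-degree d+e≡D
      where
      d+e≡D : d ℕ.+ e ≡ D
      d+e≡D = HasDegree-unique (g *P h) p (≈P-sym p (g *P h) p≈gh) (HasDegree-*P g h g-degree h-degree) p-degree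

      by-degrees : ∀ d e → HasDegree d g → HasDegree e h → d ℕ.+ e ≡ D → IsUnitP g ⊎ IsUnitP h
      by-degrees zero          e             (g<1 , g0≉0) _            _ = inj₁ (constant⇒unit g g<1 g0≉0)
      by-degrees (suc d)       zero          _            (h<1 , h0≉0) _ = inj₂ (constant⇒unit h h<1 h0≉0)
      by-degrees 1             (suc e)       g-linear     _            _ =
        let r , gr≈0 = linear-root g g-linear in ⊥-elim (rootless r (root-of-factor {p} g h r p≈gh (inj₁ gr≈0)))
      by-degrees (suc (suc d)) 1             _            h-linear     _ =
        let r , hr≈0 = linear-root h h-linear in ⊥-elim (rootless r (root-of-factor {p} g h r p≈gh (inj₂ hr≈0)))
      by-degrees (suc (suc d)) (suc (suc e)) _            _            d+e≡D
        with ℕ.≤-trans (ℕ.m≤n+m (suc (suc e)) d) (ℕ.s≤s⁻¹ (ℕ.s≤s⁻¹ (≡.subst (ℕ._≤ 3) (≡.sym d+e≡D) D≤3)))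
      ... | s≤s ()

  too-many-roots : ∀ d p → DegreeBelow d p → (x : Fin d → Carrier) → (∀ i j → x i ≈ x j → i ≡ j) →
                   (∀ i → eval p (x i) ≈ 0#) → p ≈P []
  too-many-roots zero    p p<0 x x-injective roots n = p<0 n z≤n
  too-many-roots (suc d) p p<d x x-injective roots =
    ≈P-trans p ((X- r) *P quot r p) [] p≈ (*P-zeroʳ (X- r) (quot r p) quot≈0)
    where
    r : Carrier
    r = x zero
    p≈ : p ≈P ((X- r) *P quot r p)
    p≈ = root⇒factor r p (roots zero)
    x[suc]≉r : ∀ i → x (suc i) ≉ r
    x[suc]≉r i eq with x-injective _ _ eq
    ... | ()
    quot≈0 : quot r p ≈P []
    quot≈0 = too-many-roots d (quot r p) (quot-degree r p p<d) (λ i → x (suc i))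
      (λ i j eq → Fin.suc-injective (x-injective _ _ eq))
      (λ i → root-of-cofactor {p} r (quot r p) (x (suc i)) p≈ (roots (suc i)) (x[suc]≉r i))

module FrobeniusAndTrace {c ℓ} (R : CommutativeRing c ℓ) (1+1+1≈0 : HasCharacteristic3 R) where
  open CommutativeRing R hiding (zero)
  open PolyOps R
  open Powers R
  open CharacteristicThreeSolver R 1+1+1≈0
  open import Relation.Binary.Reasoning.Setoid setoid

  frobenius : ∀ x y → pow (x + y) 3 ≈ pow x 3 + pow y 3
  frobenius = solve 2 (λ x y → (x :+ y) :^ 3 := x :^ 3 :+ y :^ 3) refl

  pow-3^suc : ∀ x k → pow x (3 ^ suc k) ≈ pow (pow x 3) (3 ^ k)
  pow-3^suc x k = sym (pow-assoc x 3 (3 ^ k))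

  pow-3^-comm : ∀ x k → pow (pow x (3 ^ k)) 3 ≈ pow (pow x 3) (3 ^ k)
  pow-3^-comm x k = begin
    pow (pow x (3 ^ k)) 3   ≈⟨ pow-assoc x (3 ^ k) 3 ⟩
    pow x (3 ^ k ℕ.* 3)     ≡⟨ ≡.cong (pow x) (ℕ.*-comm (3 ^ k) 3) ⟩
    pow x (3 ^ suc k)       ≈⟨ pow-3^suc x k ⟩
    pow (pow x 3) (3 ^ k)   ∎

  frobenius-iterated : ∀ k x y → pow (x + y) (3 ^ k) ≈ pow x (3 ^ k) + pow y (3 ^ k)
  frobenius-iterated zero    = solve 2 (λ x y → (x :+ y) :^ 1 := x :^ 1 :+ y :^ 1) refl
  frobenius-iterated (suc k) x y = begin
    pow (x + y) (3 ^ suc k)                          ≈⟨ pow-3^suc (x + y) k ⟩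
    pow (pow (x + y) 3) (3 ^ k)                      ≈⟨ pow-cong (3 ^ k) (frobenius x y) ⟩
    pow (pow x 3 + pow y 3) (3 ^ k)                  ≈⟨ frobenius-iterated k _ _ ⟩
    pow (pow x 3) (3 ^ k) + pow (pow y 3) (3 ^ k)    ≈⟨ +-cong (pow-3^suc x k) (pow-3^suc y k) ⟨
    pow x (3 ^ suc k) + pow y (3 ^ suc k)            ∎

  pow-3^-fixed : ∀ k {x} → pow x 3 ≈ x → pow x (3 ^ k) ≈ x
  pow-3^-fixed zero    {x} x³≈x = *-identityʳ x
  pow-3^-fixed (suc k) {x} x³≈x =
    trans (pow-3^suc x k) (trans (pow-cong (3 ^ k) x³≈x) (pow-3^-fixed k x³≈x))

  Tr-cong : ∀ k {x y} → x ≈ y → Tr k x ≈ Tr k y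
  Tr-cong zero    x≈y = refl
  Tr-cong (suc k) x≈y = +-cong (Tr-cong k x≈y) (pow-cong (3 ^ k) x≈y)

  Tr-+ : ∀ k x y → Tr k (x + y) ≈ Tr k x + Tr k y
  Tr-+ zero    x y = sym (+-identityˡ 0#)
  Tr-+ (suc k) x y = begin
    Tr k (x + y) + pow (x + y) (3 ^ k)                   ≈⟨ +-cong (Tr-+ k x y) (frobenius-iterated k x y) ⟩
    (Tr k x + Tr k y) + (pow x (3 ^ k) + pow y (3 ^ k))  ≈⟨ +-interchange _ _ _ _ ⟩
    (Tr k x + pow x (3 ^ k)) + (Tr k y + pow y (3 ^ k))  ∎
    where
    open import Algebra.Properties.CommutativeSemigroup +-commutativeSemigroup
      using () renaming (interchange to +-interchange)

  -- Scalars t with t³ = t are the elements of the prime field 𝔽₃.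
  Tr-scale : ∀ k {t} x → pow t 3 ≈ t → Tr k (t * x) ≈ t * Tr k x
  Tr-scale zero    {t} x t³≈t = sym (zeroʳ t)
  Tr-scale (suc k) {t} x t³≈t = begin
    Tr k (t * x) + pow (t * x) (3 ^ k)          ≈⟨ +-cong (Tr-scale k x t³≈t) (pow-distrib-* t x (3 ^ k)) ⟩
    t * Tr k x + pow t (3 ^ k) * pow x (3 ^ k)  ≈⟨ +-congˡ (*-congʳ (pow-3^-fixed k t³≈t)) ⟩
    t * Tr k x + t * pow x (3 ^ k)              ≈⟨ distribˡ t _ _ ⟨
    t * (Tr k x + pow x (3 ^ k))                ∎

  Tr-neg : ∀ k x → Tr k (- x) ≈ - Tr k x
  Tr-neg k x = begin
    Tr k (- x)       ≈⟨ Tr-cong k (-1*x≈-x x) ⟨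
    Tr k (- 1# * x)  ≈⟨ Tr-scale k x (solve 0 ((:- con 1₃) :^ 3 := :- con 1₃) refl) ⟩
    - 1# * Tr k x    ≈⟨ -1*x≈-x _ ⟩
    - Tr k x         ∎
    where open import Algebra.Properties.Ring ring using (-1*x≈-x)

  Tr-pow3-telescope : ∀ k x → Tr k (pow x 3) + x ≈ Tr k x + pow x (3 ^ k)
  Tr-pow3-telescope zero    x = trans (+-identityˡ x) (trans (sym (*-identityʳ x)) (sym (+-identityˡ _)))
  Tr-pow3-telescope (suc k) x = begin
    (Tr k (pow x 3) + pow (pow x 3) (3 ^ k)) + x   ≈⟨ solve 3 (λ a b c → (a :+ b) :+ c := (a :+ c) :+ b) refl _ _ _ ⟩
    (Tr k (pow x 3) + x) + pow (pow x 3) (3 ^ k)   ≈⟨ +-cong (Tr-pow3-telescope k x) (sym (pow-3^suc x k)) ⟩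
    (Tr k x + pow x (3 ^ k)) + pow x (3 ^ suc k)   ∎

  pow3∘Tr≈Tr∘pow3 : ∀ k x → pow (Tr k x) 3 ≈ Tr k (pow x 3)
  pow3∘Tr≈Tr∘pow3 zero    x = solve 0 (con 0₃ :^ 3 := con 0₃) refl
  pow3∘Tr≈Tr∘pow3 (suc k) x = begin
    pow (Tr k x + pow x (3 ^ k)) 3                   ≈⟨ frobenius _ _ ⟩
    pow (Tr k x) 3 + pow (pow x (3 ^ k)) 3           ≈⟨ +-cong (pow3∘Tr≈Tr∘pow3 k x) (pow-3^-comm x k) ⟩
    Tr k (pow x 3) + pow (pow x 3) (3 ^ k)           ∎

module ArtinSchreier {c ℓ} (F : FiniteField c ℓ)
  (1+1+1≈0 : HasCharacteristic3 (FiniteField.commutativeRing F))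
  (m : ℕ) (size≡3^m : FiniteField.size F ≡ 3 ^ m) where
  open FiniteField F
  open CommutativeRing commutativeRing hiding (zero)
  open PolyOps commutativeRing
  open Polynomials commutativeRing
  open PolynomialsOverFiniteField F
  open FiniteFieldProperties F
  open FrobeniusAndTrace commutativeRing 1+1+1≈0
  open CharacteristicThreeSolver commutativeRing 1+1+1≈0
  open import Algebra.Properties.Ring ring using (+-cancelˡ; +-cancelʳ; x∙y⁻¹≈ε⇒x≈y; x≈y⇒x∙y⁻¹≈ε)
  open import Relation.Binary.Reasoning.Setoid setoid

  pow-3^m : ∀ x → pow x (3 ^ m) ≈ x
  pow-3^m x = ≡.subst (λ n → pow x n ≈ x) size≡3^m (fermat x)

  Tr-pow3≈Tr : ∀ x → Tr m (pow x 3) ≈ Tr m x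
  Tr-pow3≈Tr x = +-cancelʳ x _ _ (trans (Tr-pow3-telescope m x) (+-congˡ (pow-3^m x)))

  Tr∈𝔽₃ : ∀ x → pow (Tr m x) 3 ≈ Tr m x
  Tr∈𝔽₃ x = trans (pow3∘Tr≈Tr∘pow3 m x) (Tr-pow3≈Tr x)

  Tr-y³-y : ∀ y → Tr m (pow y 3 - y) ≈ 0#
  Tr-y³-y y = begin
    Tr m (pow y 3 - y)           ≈⟨ Tr-+ m _ _ ⟩
    Tr m (pow y 3) + Tr m (- y)  ≈⟨ +-cong (Tr-pow3≈Tr y) (Tr-neg m y) ⟩
    Tr m y - Tr m y              ≈⟨ -‿inverseʳ _ ⟩
    0#                           ∎

  tracePoly : ℕ → Poly
  tracePoly zero    = []
  tracePoly (suc k) = tracePoly k +P X^ (3 ^ k)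

  eval-tracePoly : ∀ k x → eval (tracePoly k) x ≈ Tr k x
  eval-tracePoly zero    x = refl
  eval-tracePoly (suc k) x =
    trans (eval-+P (tracePoly k) _ x) (+-cong (eval-tracePoly k x) (eval-X^ (3 ^ k) x))

  private
    3^k<3^[1+k] : ∀ k → 3 ^ k ℕ.< 3 ^ suc k
    3^k<3^[1+k] k = ℕ.^-monoʳ-< 3 (s≤s (s≤s z≤n)) (ℕ.n<1+n k)

  tracePoly-degree : ∀ k → DegreeBelow (3 ^ k) (tracePoly k)
  tracePoly-degree zero    n _ = refl
  tracePoly-degree (suc k) = DegreeBelow-+P (tracePoly k) (X^ (3 ^ k))
    (DegreeBelow-mono {p = tracePoly k} (ℕ.<⇒≤ (3^k<3^[1+k] k)) (tracePoly-degree k))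
    (DegreeBelow-mono {p = X^ (3 ^ k)} (3^k<3^[1+k] k) (X^-degree (3 ^ k)))

  tracePoly-top : ∀ k → coeff (tracePoly (suc k)) (3 ^ k) ≈ 1#
  tracePoly-top k = begin
    coeff (tracePoly k +P X^ (3 ^ k)) (3 ^ k)               ≈⟨ coeff-+P (tracePoly k) _ _ ⟩
    coeff (tracePoly k) (3 ^ k) + coeff (X^ (3 ^ k)) (3 ^ k)  ≈⟨ +-cong (tracePoly-degree k _ ℕ.≤-refl) (coeff-X^ (3 ^ k)) ⟩
    0# + 1#                                                 ≈⟨ +-identityˡ 1# ⟩
    1#                                                      ∎

  -- Otherwise the trace polynomial, of degree 3^(k-1) < |F|, would have all of F as roots.
  Tr-not-identically-zero : ∀ k → size ≡ 3 ^ k → ¬ (∀ x → Tr k x ≈ 0#)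
  Tr-not-identically-zero zero    size≡1     _    = size≢1 size≡1
  Tr-not-identically-zero (suc k) size≡3^1+k Tr≈0 =
    1≉0 (trans (sym (tracePoly-top k)) (tracePoly≈0 (3 ^ k)))
    where
    tracePoly≈0 : tracePoly (suc k) ≈P []
    tracePoly≈0 = too-many-roots size (tracePoly (suc k))
      (≡.subst (λ n → DegreeBelow n (tracePoly (suc k))) (≡.sym size≡3^1+k) (tracePoly-degree (suc k)))
      enum enum-inj (λ i → trans (eval-tracePoly (suc k) (enum i)) (Tr≈0 (enum i)))

  Tr-nonzero : ∃ λ w → Tr m w ≉ 0#
  Tr-nonzero =
    let i , Tr[enum-i]≉0 = Fin.¬∀⟶∃¬ size _ (λ i → Tr m (enum i) ≟ 0#) (λ Tr∘enum≈0 →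
          Tr-not-identically-zero m size≡3^m
            (λ x → trans (Tr-cong m (sym (enum-index x))) (Tr∘enum≈0 (index x))))
    in enum i , Tr[enum-i]≉0

  private
    w : Carrier
    w = proj₁ Tr-nonzero

    e : Carrier
    e = Tr m w * w

    Tr-e : Tr m e ≈ 1#
    Tr-e = trans (Tr-scale m w (Tr∈𝔽₃ w)) t*t≈1
      where
      t : Carrier
      t = Tr m w
      t*t≈1 : t * t ≈ 1#
      t*t≈1 = *-cancelˡ (proj₂ Tr-nonzero) (begin
        t * (t * t)  ≈⟨ solve 1 (λ t → t :* (t :* t) := t :^ 3) refl t ⟩
        pow t 3      ≈⟨ Tr∈𝔽₃ w ⟩
        t            ≈⟨ *-identityʳ t ⟨
        t * 1#       ∎)

    H : Carrier → Carrier
    H y = (pow y 3 - y) + Tr m (e * y) * e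

    Tr-H : ∀ y → Tr m (H y) ≈ Tr m (e * y)
    Tr-H y = begin
      Tr m (H y)                                         ≈⟨ Tr-+ m _ _ ⟩
      Tr m (pow y 3 - y) + Tr m (Tr m (e * y) * e)       ≈⟨ +-cong (Tr-y³-y y) (Tr-scale m e (Tr∈𝔽₃ _)) ⟩
      0# + Tr m (e * y) * Tr m e                         ≈⟨ +-identityˡ _ ⟩
      Tr m (e * y) * Tr m e                              ≈⟨ *-congˡ Tr-e ⟩
      Tr m (e * y) * 1#                                  ≈⟨ *-identityʳ _ ⟩
      Tr m (e * y)                                       ∎

    H-injective : ∀ {y z} → H y ≈ H z → y ≈ z
    H-injective {y} {z} Hy≈Hz = x∙y⁻¹≈ε⇒x≈y y z d≈0
      where
      Tr[ey]≈Tr[ez] : Tr m (e * y) ≈ Tr m (e * z)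
      Tr[ey]≈Tr[ez] = trans (sym (Tr-H y)) (trans (Tr-cong m Hy≈Hz) (Tr-H z))
      y³-y≈z³-z : pow y 3 - y ≈ pow z 3 - z
      y³-y≈z³-z = +-cancelʳ _ _ _ (trans Hy≈Hz (+-congˡ (*-congʳ (sym Tr[ey]≈Tr[ez]))))
      d : Carrier
      d = y - z
      d³≈d : pow d 3 ≈ d
      d³≈d = x∙y⁻¹≈ε⇒x≈y _ _ (begin
        pow d 3 - d                      ≈⟨ solve 2 (λ y z → (y :- z) :^ 3 :- (y :- z) :=
                                              (y :^ 3 :- y) :- (z :^ 3 :- z)) refl y z ⟩
        (pow y 3 - y) - (pow z 3 - z)    ≈⟨ x≈y⇒x∙y⁻¹≈ε y³-y≈z³-z ⟩
        0#                               ∎)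
      d≈0 : d ≈ 0#
      d≈0 = +-cancelˡ (Tr m (e * z)) _ _ (begin
        Tr m (e * z) + d                 ≈⟨ +-congˡ (trans (Tr-scale m e d³≈d) (trans (*-congˡ Tr-e) (*-identityʳ d))) ⟨
        Tr m (e * z) + Tr m (d * e)      ≈⟨ Tr-+ m _ _ ⟨
        Tr m (e * z + d * e)             ≈⟨ Tr-cong m (solve 3 (λ e y z → e :* z :+ (y :- z) :* e := e :* y) refl e y z) ⟩
        Tr m (e * y)                     ≈⟨ Tr[ey]≈Tr[ez] ⟩
        Tr m (e * z)                     ≈⟨ +-identityʳ _ ⟨
        Tr m (e * z) + 0#                ∎)

  -- As Tr e = 1, H y = y³ − y + Tr(e y)·e is injective, hence onto, and H y = b forces
  -- Tr(e y) = Tr b = 0.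
  artinSchreier : ∀ b → Tr m b ≈ 0# → ∃ λ y → pow y 3 - y ≈ b
  artinSchreier b Trb≈0 = y , (begin
    pow y 3 - y                      ≈⟨ +-identityʳ _ ⟨
    pow y 3 - y + 0#                 ≈⟨ +-congˡ (trans (*-congʳ Tr[ey]≈0) (zeroˡ e)) ⟨
    H y                              ≈⟨ Hy≈b ⟩
    b                                ∎)
    where
    y : Carrier
    y = proj₁ (injective⇒surjective H H-injective b)
    Hy≈b : H y ≈ b
    Hy≈b = proj₂ (injective⇒surjective H H-injective b)
    Tr[ey]≈0 : Tr m (e * y) ≈ 0#
    Tr[ey]≈0 = trans (sym (Tr-H y)) (trans (Tr-cong m Hy≈b) Trb≈0)

module Cubic {c ℓ} (F : FiniteField c ℓ)
  (1+1+1≈0 : HasCharacteristic3 (FiniteField.commutativeRing F))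
  (m : ℕ) (size≡3^m : FiniteField.size F ≡ 3 ^ m)
  (a : CommutativeRing.Carrier (FiniteField.commutativeRing F)) where
  open FiniteField F
  open CommutativeRing commutativeRing hiding (zero)
  open PolyOps commutativeRing
  open Powers commutativeRing
  open Polynomials commutativeRing
  open PolynomialsOverFiniteField F
  open FiniteFieldProperties F
  open FrobeniusAndTrace commutativeRing 1+1+1≈0
  open ArtinSchreier F 1+1+1≈0 m size≡3^m
  open CharacteristicThreeSolver commutativeRing 1+1+1≈0
  open import Algebra.Properties.Ring ring
    using (+-cancelˡ; x∙y⁻¹≈ε⇒x≈y; x≈y⇒x∙y⁻¹≈ε; +-inverseˡ-unique; +-inverseʳ-unique; -‿involutive; -0#≈0#)
  open import Relation.Binary.Reasoning.Setoid setoid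

  f : Poly
  f = (a * a) ∷ a ∷ 0# ∷ 1# ∷ []

  f-degree : HasDegree 3 f
  f-degree = length-degree f , 1≉0

  eval-f : ∀ x → eval f x ≈ pow x 3 + a * x + a * a
  eval-f = solve 2 (λ a x → a :* a :+ x :* (a :+ x :* (con 0₃ :+ x :* (con 1₃ :+ x :* con 0₃)))
                           := x :^ 3 :+ a :* x :+ a :* a) refl a

  a≈-b² : ∀ {b} → - a ≈ b * b → a ≈ - (b * b)
  a≈-b² -a≈b² = trans (sym (-‿involutive a)) (-‿cong -a≈b²)

  -a≈b²⇒-a≉0 : ∀ {b} → - a ≈ b * b → b ≉ 0# → - a ≉ 0#
  -a≈b²⇒-a≉0 -a≈b² b≉0 -a≈0 = x*y≉0 b≉0 b≉0 (trans (sym -a≈b²) -a≈0)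

  b≈0⇒a≈0 : ∀ {b} → - a ≈ b * b → b ≈ 0# → a ≈ 0#
  b≈0⇒a≈0 {b} -a≈b² b≈0 = trans (a≈-b² -a≈b²) (trans (-‿cong (trans (*-congʳ b≈0) (zeroˡ b))) -0#≈0#)

  distinct-roots⇒-a≈square : ∀ {x z} → eval f x ≈ 0# → eval f z ≈ 0# → x ≉ z → - a ≈ (x - z) * (x - z)
  distinct-roots⇒-a≈square {x} {z} fx≈0 fz≈0 x≉z =
    sym (+-inverseˡ-unique _ a (x*y≈0⇒y≈0 (x-y≉0 x≉z) (begin
      (x - z) * ((x - z) * (x - z) + a)                        ≈⟨ solve 3 (λ a x z →
            (x :- z) :* ((x :- z) :* (x :- z) :+ a) :=
            (x :^ 3 :+ a :* x :+ a :* a) :- (z :^ 3 :+ a :* z :+ a :* a)) refl a x z ⟩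
      (pow x 3 + a * x + a * a) - (pow z 3 + a * z + a * a)  ≈⟨ +-cong (trans (sym (eval-f x)) fx≈0)
                                                                       (-‿cong (trans (sym (eval-f z)) fz≈0)) ⟩
      0# - 0#                                                  ≈⟨ -‿inverseʳ 0# ⟩
      0#                                                       ∎)))

  root⇒Tr≈0 : ∀ {b x} → - a ≈ b * b → b ≉ 0# → eval f x ≈ 0# → Tr m b ≈ 0#
  root⇒Tr≈0 {b} {x} -a≈b² b≉0 fx≈0 = begin
    Tr m b                      ≈⟨ Tr-cong m b≈-[y³-y] ⟩
    Tr m (- (pow y 3 - y))      ≈⟨ Tr-neg m _ ⟩
    - Tr m (pow y 3 - y)        ≈⟨ -‿cong (Tr-y³-y y) ⟩
    - 0#                        ≈⟨ -0#≈0# ⟩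
    0#                          ∎
    where
    y : Carrier
    y = inv b b≉0 * x
    by≈x : b * y ≈ x
    by≈x = *-inverse-cancel (inverseʳ b b≉0) x
    b≈-[y³-y] : b ≈ - (pow y 3 - y)
    b≈-[y³-y] = +-inverseʳ-unique _ b (x*y≈0⇒y≈0 (x*y≉0 (x*y≉0 b≉0 b≉0) b≉0) (begin
      b * b * b * (pow y 3 - y + b)                                 ≈⟨ solve 2 (λ b y →
            b :* b :* b :* (y :^ 3 :- y :+ b) :=
            (b :* y) :^ 3 :+ (:- (b :* b)) :* (b :* y) :+ (:- (b :* b)) :* (:- (b :* b))) refl b y ⟩
      pow (b * y) 3 + - (b * b) * (b * y) + - (b * b) * - (b * b)   ≈⟨ +-cong (+-cong (pow-cong 3 (sym by≈x)) (*-cong a≈b² (sym by≈x)))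
                                                                             (*-cong a≈b² a≈b²) ⟨
      pow x 3 + a * x + a * a                                       ≈⟨ eval-f x ⟨
      eval f x                                                      ≈⟨ fx≈0 ⟩
      0#                                                            ∎))
      where
      a≈b² : a ≈ - (b * b)
      a≈b² = a≈-b² -a≈b²

  vieta : ∀ α β γ → ((X- α) *P ((X- β) *P (X- γ))) ≈P
            (- (α * β * γ) ∷ (α * β + α * γ + β * γ) ∷ - (α + β + γ) ∷ 1# ∷ [])
  vieta α β γ 0 = solve 3 (λ α β γ →
    (:- α) :* ((:- β) :* (:- γ) :+ con 0₃) :+ con 0₃ := :- (α :* β :* γ)) refl α β γ
  vieta α β γ 1 = solve 3 (λ α β γ →
    (:- α) :* ((:- β) :* con 1₃ :+ (con 1₃ :* (:- γ) :+ con 0₃))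
      :+ (con 1₃ :* ((:- β) :* (:- γ) :+ con 0₃) :+ con 0₃)
    := α :* β :+ α :* γ :+ β :* γ) refl α β γ
  vieta α β γ 2 = solve 3 (λ α β γ →
    (:- α) :* (con 1₃ :* con 1₃) :+ con 1₃ :* ((:- β) :* con 1₃ :+ (con 1₃ :* (:- γ) :+ con 0₃))
    := :- (α :+ β :+ γ)) refl α β γ
  vieta α β γ 3 = solve 0 (con 1₃ :* (con 1₃ :* con 1₃) := con 1₃) refl
  vieta α β γ (suc (suc (suc (suc n)))) = refl

  SplitsWithDistinctRoots : Set (c ⊔ ℓ)
  SplitsWithDistinctRoots = ∃ λ α → ∃ λ β → ∃ λ γ → α ≉ β × α ≉ γ × β ≉ γ ×
                            (f ≈P ((X- α) *P ((X- β) *P (X- γ))))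

  splitting-roots : ∀ α β γ → f ≈P ((X- α) *P ((X- β) *P (X- γ))) → eval f α ≈ 0# × eval f β ≈ 0#
  splitting-roots α β γ f≈ =
    root-of-factor {f} (X- α) ((X- β) *P (X- γ)) α f≈ (inj₁ (eval-X-self α)) ,
    root-of-factor {f} (X- α) ((X- β) *P (X- γ)) β f≈ (inj₂ β-root)
    where
    β-root : eval ((X- β) *P (X- γ)) β ≈ 0#
    β-root = root-of-factor {(X- β) *P (X- γ)} (X- β) (X- γ) β (λ _ → refl) (inj₁ (eval-X-self β))

  Tr≈0⇒splits : ∀ {b} → - a ≈ b * b → b ≉ 0# → Tr m b ≈ 0# → SplitsWithDistinctRoots
  Tr≈0⇒splits {b} -a≈b² b≉0 Trb≈0 =
    α , β , γ , b*-≉ (x≉x+c y 1≉0) , b*-≉ y≉y+1+1 , b*-≉ (x≉x+c (y + 1#) 1≉0) ,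
    λ n → trans (coefficients n) (sym (vieta α β γ n))
    where
    Tr[-b]≈0 : Tr m (- b) ≈ 0#
    Tr[-b]≈0 = trans (Tr-neg m b) (trans (-‿cong Trb≈0) -0#≈0#)
    y : Carrier
    y = proj₁ (artinSchreier (- b) Tr[-b]≈0)
    y³-y≈-b : pow y 3 - y ≈ - b
    y³-y≈-b = proj₂ (artinSchreier (- b) Tr[-b]≈0)
    α β γ : Carrier
    α = b * y
    β = b * (y + 1#)
    γ = b * (y + 1# + 1#)

    b*-≉ : ∀ {u v} → u ≉ v → b * u ≉ b * v
    b*-≉ u≉v bu≈bv = u≉v (*-cancelˡ b≉0 bu≈bv)
    x≉x+c : ∀ x {c} → c ≉ 0# → x ≉ x + c
    x≉x+c x c≉0 x≈x+c = c≉0 (sym (+-cancelˡ x 0# _ (trans (+-identityʳ x) x≈x+c)))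
    y≉y+1+1 : y ≉ y + 1# + 1#
    y≉y+1+1 eq = x≉x+c y 1+1≉0 (trans eq (+-assoc y 1# 1#))
      where
      1+1≉0 : 1# + 1# ≉ 0#
      1+1≉0 2≈0 = 1≉0 (trans (sym (trans (+-congʳ 2≈0) (+-identityˡ 1#))) 1+1+1≈0)

    a≈b² : a ≈ - (b * b)
    a≈b² = a≈-b² -a≈b²
    coefficients : f ≈P (- (α * β * γ) ∷ (α * β + α * γ + β * γ) ∷ - (α + β + γ) ∷ 1# ∷ [])
    coefficients 0 = begin
      a * a                            ≈⟨ *-cong a≈b² a≈b² ⟩
      - (b * b) * - (b * b)            ≈⟨ solve 1 (λ b → (:- (b :* b)) :* (:- (b :* b)) := :- (b :* b :* b :* (:- b))) refl b ⟩
      - (b * b * b * - b)              ≈⟨ -‿cong (*-congˡ y³-y≈-b) ⟨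
      - (b * b * b * (pow y 3 - y))    ≈⟨ solve 2 (λ b y → :- (b :* b :* b :* (y :^ 3 :- y)) :=
                                            :- ((b :* y) :* (b :* (y :+ con 1₃)) :* (b :* (y :+ con 1₃ :+ con 1₃))))
                                            refl b y ⟩
      - (α * β * γ)                    ∎
    coefficients 1 = trans a≈b² (solve 2 (λ b y → :- (b :* b) :=
      (b :* y) :* (b :* (y :+ con 1₃)) :+ (b :* y) :* (b :* (y :+ con 1₃ :+ con 1₃))
        :+ (b :* (y :+ con 1₃)) :* (b :* (y :+ con 1₃ :+ con 1₃))) refl b y)
    coefficients 2 = solve 2 (λ b y → con 0₃ :=
      :- ((b :* y) :+ (b :* (y :+ con 1₃)) :+ (b :* (y :+ con 1₃ :+ con 1₃)))) refl b y
    coefficients 3 = refl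
    coefficients (suc (suc (suc (suc n)))) = refl

  private
    square-quotient : ∀ {u x b} → u ≉ 0# → u * u * x ≈ b * b → IsSquare x
    square-quotient {u} {x} {b} u≉0 u²x≈b² = b * i , (begin
      x                          ≈⟨ *-inverse-cancel (inverseˡ u u≉0) x ⟨
      i * (u * x)                ≈⟨ *-inverse-cancel (inverseˡ u u≉0) _ ⟨
      i * (u * (i * (u * x)))    ≈⟨ solve 3 (λ x u i → i :* (u :* (i :* (u :* x))) := (i :* i) :* (u :* u :* x)) refl x u i ⟩
      (i * i) * (u * u * x)      ≈⟨ *-congˡ u²x≈b² ⟩
      (i * i) * (b * b)          ≈⟨ solve 2 (λ i b → (i :* i) :* (b :* b) := (b :* i) :* (b :* i)) refl i b ⟩
      (b * i) * (b * i)          ∎)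
      where i = inv u u≉0

    x-1≉0 : ∀ {x} → ¬ IsSquare x → x - 1# ≉ 0#
    x-1≉0 x-nonsquare x-1≈0 = x-nonsquare (1# , trans (x∙y⁻¹≈ε⇒x≈y _ _ x-1≈0) (sym (*-identityˡ 1#)))

    -- G fixes squares and maps non-squares to non-squares. Being injective, it is onto, so a
    -- non-square −a is (x − 1)² x for a non-square x, and then −(x − 1) x is a root of f.
    G : ∀ x → Dec (IsSquare x) → Carrier
    G x (yes _) = x
    G x (no  _) = (x - 1#) * (x - 1#) * x

    G-injective : ∀ x y dx dy → G x dx ≈ G y dy → x ≈ y
    G-injective x y (yes _) (yes _) x≈y = x≈y
    G-injective x y (no x-nonsquare) (yes (b , y≈b²)) Gx≈y =
      ⊥-elim (x-nonsquare (square-quotient (x-1≉0 x-nonsquare) (trans Gx≈y y≈b²)))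
    G-injective x y (yes (b , x≈b²)) (no y-nonsquare) x≈Gy =
      ⊥-elim (y-nonsquare (square-quotient (x-1≉0 y-nonsquare) (trans (sym x≈Gy) x≈b²)))
    G-injective x y (no x-nonsquare) (no _) Gx≈Gy with x ≟ y
    ... | yes x≈y = x≈y
    ... | no  x≉y = ⊥-elim (x-nonsquare (d + 1# , sym (begin
      (d + 1#) * (d + 1#)           ≈⟨ solve 2 (λ x y → ((x :- y) :+ con 1₃) :* ((x :- y) :+ con 1₃) :=
                                         x :+ ((x :- y) :* (x :- y) :+ x :+ y :+ con 1₃)) refl x y ⟩
      x + (d * d + x + y + 1#)      ≈⟨ +-congˡ d²+x+y+1≈0 ⟩
      x + 0#                        ≈⟨ +-identityʳ x ⟩
      x                             ∎)))
      where
      d : Carrier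
      d = x - y
      d²+x+y+1≈0 : d * d + x + y + 1# ≈ 0#
      d²+x+y+1≈0 = x*y≈0⇒y≈0 (x-y≉0 x≉y) (begin
        d * (d * d + x + y + 1#)                              ≈⟨ solve 2 (λ x y →
              (x :- y) :* ((x :- y) :* (x :- y) :+ x :+ y :+ con 1₃) :=
              (x :- con 1₃) :* (x :- con 1₃) :* x :- (y :- con 1₃) :* (y :- con 1₃) :* y) refl x y ⟩
        (x - 1#) * (x - 1#) * x - (y - 1#) * (y - 1#) * y    ≈⟨ x≈y⇒x∙y⁻¹≈ε Gx≈Gy ⟩
        0#                                                    ∎)

    root-from-G : ¬ IsSquare (- a) → ∀ x dx → G x dx ≈ - a → ∃ λ r → eval f r ≈ 0#
    root-from-G -a-nonsquare x (yes x-square) x≈-a =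
      ⊥-elim (-a-nonsquare (proj₁ x-square , trans (sym x≈-a) (proj₂ x-square)))
    root-from-G -a-nonsquare x (no _) Gx≈-a = r , (begin
      eval f r                    ≈⟨ eval-f r ⟩
      pow r 3 + a * r + a * a     ≈⟨ +-cong (+-congˡ (*-congʳ a≈)) (*-cong a≈ a≈) ⟩
      pow r 3 + - Gx * r + - Gx * - Gx  ≈⟨ solve 1 (λ x → (:- ((x :- con 1₃) :* x)) :^ 3
            :+ (:- ((x :- con 1₃) :* (x :- con 1₃) :* x)) :* (:- ((x :- con 1₃) :* x))
            :+ (:- ((x :- con 1₃) :* (x :- con 1₃) :* x)) :* (:- ((x :- con 1₃) :* (x :- con 1₃) :* x))
            := con 0₃) refl x ⟩
      0#                          ∎)
      where
      Gx r : Carrier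
      Gx = (x - 1#) * (x - 1#) * x
      r = - ((x - 1#) * x)
      a≈ : a ≈ - Gx
      a≈ = trans (sym (-‿involutive a)) (-‿cong (sym Gx≈-a))

  nonsquare⇒root : ¬ IsSquare (- a) → ∃ λ r → eval f r ≈ 0#
  nonsquare⇒root -a-nonsquare = root-from-G -a-nonsquare x (isSquare? x) Gx≈-a
    where
    G-onto : ∃ λ x → G x (isSquare? x) ≈ - a
    G-onto = injective⇒surjective (λ x → G x (isSquare? x))
                                  (λ {x} {y} → G-injective x y (isSquare? x) (isSquare? y)) (- a)
    x : Carrier
    x = proj₁ G-onto
    Gx≈-a : G x (isSquare? x) ≈ - a
    Gx≈-a = proj₂ G-onto

  -a≉0⇒b≉0 : ∀ {b} → - a ≈ b * b → - a ≉ 0# → b ≉ 0#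
  -a≉0⇒b≉0 {b} -a≈b² -a≉0 b≈0 = -a≉0 (trans -a≈b² (trans (*-congʳ b≈0) (zeroˡ b)))

  a≈0⇒f[0]≈0 : a ≈ 0# → eval f 0# ≈ 0#
  a≈0⇒f[0]≈0 a≈0 = begin
    eval f 0#                    ≈⟨ eval-f 0# ⟩
    pow 0# 3 + a * 0# + a * a    ≈⟨ +-cong (+-congˡ (*-congʳ a≈0)) (*-cong a≈0 a≈0) ⟩
    pow 0# 3 + 0# * 0# + 0# * 0# ≈⟨ solve 0 (con 0₃ :^ 3 :+ con 0₃ :* con 0₃ :+ con 0₃ :* con 0₃ := con 0₃) refl ⟩
    0#                           ∎

  f-rootless : IrreducibleP f → ∀ r → eval f r ≉ 0#
  f-rootless f-irreducible r fr≈0 = root⇒reducible f r (s≤s (s≤s z≤n)) f-degree fr≈0 f-irreducible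

  irreducible-criterion : IrreducibleP f ⇔ (∃ λ b → (- a ≈ b * b) × ¬ (- a ≈ 0#) × ¬ (Tr m b ≈ 0#))
  irreducible-criterion = mk⇔ to from
    where
    to : IrreducibleP f → ∃ λ b → (- a ≈ b * b) × ¬ (- a ≈ 0#) × ¬ (Tr m b ≈ 0#)
    to f-irreducible with isSquare? (- a)
    ... | no -a-nonsquare =
      let r , fr≈0 = nonsquare⇒root -a-nonsquare in ⊥-elim (f-rootless f-irreducible r fr≈0)
    ... | yes (b , -a≈b²) with b ≟ 0#
    ...   | yes b≈0 = ⊥-elim (f-rootless f-irreducible 0# (a≈0⇒f[0]≈0 (b≈0⇒a≈0 -a≈b² b≈0)))
    ...   | no  b≉0 with Tr m b ≟ 0#
    ...     | yes Trb≈0 =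
      let α , β , γ , _ , _ , _ , f≈ = Tr≈0⇒splits -a≈b² b≉0 Trb≈0
      in ⊥-elim (f-rootless f-irreducible α (proj₁ (splitting-roots α β γ f≈)))
    ...     | no  Trb≉0 = b , -a≈b² , -a≈b²⇒-a≉0 -a≈b² b≉0 , Trb≉0

    from : (∃ λ b → (- a ≈ b * b) × ¬ (- a ≈ 0#) × ¬ (Tr m b ≈ 0#)) → IrreducibleP f
    from (b , -a≈b² , -a≉0 , Trb≉0) = rootless⇒irreducible f (s≤s (s≤s z≤n)) ℕ.≤-refl f-degree
      (λ x fx≈0 → Trb≉0 (root⇒Tr≈0 -a≈b² (-a≉0⇒b≉0 -a≈b² -a≉0) fx≈0))

  private
    pow3≈0⇒≈0 : ∀ {x} → pow x 3 ≈ 0# → x ≈ 0#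
    pow3≈0⇒≈0 {x} x³≈0 with x ≟ 0#
    ... | yes x≈0 = x≈0
    ... | no  x≉0 = ⊥-elim (x*y≉0 x≉0 (x*y≉0 x≉0 (x*y≉0 x≉0 1≉0)) x³≈0)

    -- Q(r) = f′(r) = 3r² + a = a.
    eval-quot-f : ∀ r → eval (quot r f) r ≈ a
    eval-quot-f = solve 2 (λ a r →
      (a :+ r :* (con 0₃ :+ r :* (con 1₃ :+ r :* con 0₃)))
        :+ r :* ((con 0₃ :+ r :* (con 1₃ :+ r :* con 0₃)) :+ r :* ((con 1₃ :+ r :* con 0₃) :+ r :* con 0₃))
      := a) refl a

  splits⇒another-root : SplitsWithDistinctRoots → ∀ α → ∃ λ ρ → eval f ρ ≈ 0# × ρ ≉ α
  splits⇒another-root (α₁ , α₂ , α₃ , α₁≉α₂ , _ , _ , f≈) α with α₁ ≟ α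
  ... | yes α₁≈α = α₂ , proj₂ (splitting-roots α₁ α₂ α₃ f≈) , λ α₂≈α → α₁≉α₂ (trans α₁≈α (sym α₂≈α))
  ... | no  α₁≉α = α₁ , proj₁ (splitting-roots α₁ α₂ α₃ f≈) , α₁≉α

  a≈0⇒cofactor[0]≈0 : ∀ α Q → a ≈ 0# → f ≈P ((X- α) *P Q) → eval Q 0# ≈ 0#
  a≈0⇒cofactor[0]≈0 α Q a≈0 f≈ = begin
    eval Q 0#         ≈⟨ eval-at-0 Q ⟩
    coeff Q 0         ≈⟨ x∙y⁻¹≈ε⇒x≈y _ _ (trans (sym (trans (f≈ 1) (coeff-X-*P-suc α Q 0))) a≈0) ⟩
    α * coeff Q 1     ≈⟨ trans (*-congʳ α≈0) (zeroˡ _) ⟩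
    0#                ∎
    where
    α≈0 : α ≈ 0#
    α≈0 = pow3≈0⇒≈0 (begin
      pow α 3                      ≈⟨ +-identityʳ _ ⟨
      pow α 3 + 0#                 ≈⟨ +-cong (+-identityʳ _) (zeroˡ 0#) ⟨
      pow α 3 + 0# + 0# * 0#       ≈⟨ +-cong (+-congˡ (trans (*-congʳ a≈0) (zeroˡ α))) (*-cong a≈0 a≈0) ⟨
      pow α 3 + a * α + a * a      ≈⟨ eval-f α ⟨
      eval f α                     ≈⟨ root-of-factor {f} (X- α) Q α f≈ (inj₁ (eval-X-self α)) ⟩
      0#                           ∎)

  rootless-cofactor⇒nonsquare : ∀ α Q → f ≈P ((X- α) *P Q) → (∀ ρ → eval Q ρ ≉ 0#) → ¬ IsSquare (- a)
  rootless-cofactor⇒nonsquare α Q f≈ Q-rootless (b , -a≈b²) with b ≟ 0#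
  ... | yes b≈0 = Q-rootless 0# (a≈0⇒cofactor[0]≈0 α Q (b≈0⇒a≈0 -a≈b² b≈0) f≈)
  ... | no  b≉0 =
    let fα≈0 = root-of-factor {f} (X- α) Q α f≈ (inj₁ (eval-X-self α))
        ρ , fρ≈0 , ρ≉α = splits⇒another-root (Tr≈0⇒splits -a≈b² b≉0 (root⇒Tr≈0 -a≈b² b≉0 fα≈0)) α
    in Q-rootless ρ (root-of-cofactor {f} α Q ρ f≈ fρ≈0 ρ≉α)

  private
    quot-f-leading≉0 : ∀ r → 1# + r * 0# ≉ 0#
    quot-f-leading≉0 r eq = 1≉0 (trans (sym (trans (+-congˡ (zeroʳ r)) (+-identityʳ 1#))) eq)

  quot-irreducible : ¬ IsSquare (- a) → ∀ r → eval f r ≈ 0# → IrreducibleP (quot r f)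
  quot-irreducible -a-nonsquare r fr≈0 =
    rootless⇒irreducible (quot r f) ℕ.≤-refl (s≤s (s≤s z≤n))
      (length-degree (quot r f) , quot-f-leading≉0 r) Q-rootless
    where
    Q-rootless : ∀ ρ → eval (quot r f) ρ ≉ 0#
    Q-rootless ρ Qρ≈0 with ρ ≟ r
    ... | yes ρ≈r = -a-nonsquare (0# , trans (-‿cong a≈0′) (trans -0#≈0# (sym (zeroˡ 0#))))
      where
      a≈0′ : a ≈ 0#
      a≈0′ = trans (sym (eval-quot-f r)) (trans (eval-cong (quot r f) (sym ρ≈r)) Qρ≈0)
    ... | no  ρ≉r = -a-nonsquare (ρ - r , distinct-roots⇒-a≈square fρ≈0 fr≈0 ρ≉r)
      where
      fρ≈0 : eval f ρ ≈ 0#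
      fρ≈0 = root-of-factor {f} (X- r) (quot r f) ρ (root⇒factor r f fr≈0) (inj₂ Qρ≈0)

  linear×irreducible-criterion : (∃ λ α → ∃ λ Q → (f ≈P ((X- α) *P Q)) × IsQuadratic Q × IrreducibleP Q)
                        ⇔ (¬ IsSquare (- a))
  linear×irreducible-criterion = mk⇔ to from
    where
    to : (∃ λ α → ∃ λ Q → (f ≈P ((X- α) *P Q)) × IsQuadratic Q × IrreducibleP Q) → ¬ IsSquare (- a)
    to (α , Q , f≈ , Q-quadratic , Q-irreducible) = rootless-cofactor⇒nonsquare α Q f≈
      (λ ρ Qρ≈0 → root⇒reducible Q ρ ℕ.≤-refl (quadratic-degree Q Q-quadratic) Qρ≈0 Q-irreducible)

    from : ¬ IsSquare (- a) → ∃ λ α → ∃ λ Q → (f ≈P ((X- α) *P Q)) × IsQuadratic Q × IrreducibleP Q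
    from -a-nonsquare =
      let r , fr≈0 = nonsquare⇒root -a-nonsquare
      in r , quot r f , root⇒factor r f fr≈0 , (_ , _ , _ , ≡.refl , quot-f-leading≉0 r) ,
         quot-irreducible -a-nonsquare r fr≈0

  -- The X² coefficient gives α + 2β = 0, that is α = β in characteristic 3.
  no-simple×double-factorisation : ¬ (∃ λ α → ∃ λ β → ¬ (α ≈ β) × (f ≈P ((X- α) *P ((X- β) *P (X- β)))))
  no-simple×double-factorisation (α , β , α≉β , f≈) = α≉β (sym (x∙y⁻¹≈ε⇒x≈y β α (begin
    β - α           ≈⟨ solve 2 (λ α β → β :- α := :- (α :+ β :+ β)) refl α β ⟩
    - (α + β + β)   ≈⟨ trans (f≈ 2) (vieta α β β 2) ⟨
    0#              ∎)))

  triple-root-criterion : (∃ λ α → f ≈P ((X- α) *P ((X- α) *P (X- α)))) ⇔ (a ≈ 0#)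
  triple-root-criterion = mk⇔ to from
    where
    to : (∃ λ α → f ≈P ((X- α) *P ((X- α) *P (X- α)))) → a ≈ 0#
    to (α , f≈) = trans (f≈ 1) (trans (vieta α α α 1)
      (solve 1 (λ α → α :* α :+ α :* α :+ α :* α := con 0₃) refl α))

    from : a ≈ 0# → ∃ λ α → f ≈P ((X- α) *P ((X- α) *P (X- α)))
    from a≈0 = 0# , λ n → trans (coefficients n) (sym (vieta 0# 0# 0# n))
      where
      coefficients : f ≈P (- (0# * 0# * 0#) ∷ (0# * 0# + 0# * 0# + 0# * 0#) ∷ - (0# + 0# + 0#) ∷ 1# ∷ [])
      coefficients 0 = trans (*-cong a≈0 a≈0) (solve 0 (con 0₃ :* con 0₃ := :- (con 0₃ :* con 0₃ :* con 0₃)) refl)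
      coefficients 1 = trans a≈0 (solve 0 (con 0₃ := con 0₃ :* con 0₃ :+ con 0₃ :* con 0₃ :+ con 0₃ :* con 0₃) refl)
      coefficients 2 = solve 0 (con 0₃ := :- (con 0₃ :+ con 0₃ :+ con 0₃)) refl
      coefficients 3 = refl
      coefficients (suc (suc (suc (suc n)))) = refl

  three-distinct-roots-criterion : SplitsWithDistinctRoots ⇔ (∃ λ b → (- a ≈ b * b) × ¬ (- a ≈ 0#) × (Tr m b ≈ 0#))
  three-distinct-roots-criterion = mk⇔ to from
    where
    to : SplitsWithDistinctRoots → ∃ λ b → (- a ≈ b * b) × ¬ (- a ≈ 0#) × (Tr m b ≈ 0#)
    to (α , β , γ , α≉β , _ , _ , f≈) =
      α - β , -a≈[α-β]² , -a≈b²⇒-a≉0 -a≈[α-β]² α-β≉0 , root⇒Tr≈0 -a≈[α-β]² α-β≉0 fα≈0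
      where
      fα≈0 : eval f α ≈ 0#
      fα≈0 = proj₁ (splitting-roots α β γ f≈)
      -a≈[α-β]² : - a ≈ (α - β) * (α - β)
      -a≈[α-β]² = distinct-roots⇒-a≈square fα≈0 (proj₂ (splitting-roots α β γ f≈)) α≉β
      α-β≉0 : α - β ≉ 0#
      α-β≉0 = x-y≉0 α≉β

    from : (∃ λ b → (- a ≈ b * b) × ¬ (- a ≈ 0#) × (Tr m b ≈ 0#)) → SplitsWithDistinctRoots
    from (b , -a≈b² , -a≉0 , Trb≈0) = Tr≈0⇒splits -a≈b² (-a≉0⇒b≉0 -a≈b² -a≉0) Trb≈0

mainTheorem10 : ∀ {c ℓ} (F : FiniteField c ℓ) (m : ℕ) →
  FiniteField.size F ≡ 3 ^ m →
  let open FiniteField F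
      open CommutativeRing commutativeRing
      open PolyOps commutativeRing
  in (1# + 1# + 1# ≈ 0#) →
  (a : Carrier) →
  let f = (a * a) ∷ a ∷ 0# ∷ 1# ∷ []
  in (IrreducibleP f ⇔ (∃ λ b → (- a ≈ b * b) × ¬ (- a ≈ 0#) × ¬ (Tr m b ≈ 0#)))
   × ((∃ λ α → ∃ λ Q → (f ≈P ((X- α) *P Q)) × IsQuadratic Q × IrreducibleP Q)
        ⇔ (¬ IsSquare (- a)))
   × ¬ (∃ λ α → ∃ λ β → ¬ (α ≈ β) × (f ≈P ((X- α) *P ((X- β) *P (X- β)))))
   × ((∃ λ α → f ≈P ((X- α) *P ((X- α) *P (X- α)))) ⇔ (a ≈ 0#))
   × ((∃ λ α → ∃ λ β → ∃ λ γ → ¬ (α ≈ β) × ¬ (α ≈ γ) × ¬ (β ≈ γ)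
         × (f ≈P ((X- α) *P ((X- β) *P (X- γ)))))
        ⇔ (∃ λ b → (- a ≈ b * b) × ¬ (- a ≈ 0#) × (Tr m b ≈ 0#)))
mainTheorem10 F m size≡3^m 1+1+1≈0 a =
  irreducible-criterion , linear×irreducible-criterion , no-simple×double-factorisation ,
  triple-root-criterion , three-distinct-roots-criterion
  where open Cubic F 1+1+1≈0 m size≡3^m a
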